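{- Let $k$ and $M$ be positive integers, and let $M=p_{1}^{e_{1}}p_{2}^{e_{2}}\cdots p_{l}^{e_{l}}$ be the prime factorization of $M$, where $p_1,\dots,p_l$ are distinct primes. For any integer $n\geq \max\{e_j \mid 1\leq j\leq l\}$, \[ \sum_{i=0}^{\varphi(M)-1}B^{(-k)}_{n+i}\equiv \sum_{i=0}^{\varphi(M)-1}B^{(-n-i)}_{k}\equiv 0\pmod{M}. \]
   Context: For any integer $k$, let $\mathrm{Li}_k(t)=\sum_{n\geq 1} t^n/n^k$ (for $k\le 0$ this is a rational function of $t$). The poly-Bernoulli numbers $B^{(k)}_n$ ($n\geq 0$) are defined by \[ \frac{\mathrm{Li}_{k}(1-e^{ -t})}{1-e^{ -t}}=\sum_{n=0}^{\infty}B^{(k)}_{n}\frac{t^n}{n!}. \] For negative upper index these are positive integers. $\varphi$ denotes Euler's totient function. -}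

module Defs where

open import Data.Nat as ℕ using (ℕ; zero; suc)
open import Data.Nat.GCD using (gcd)
open import Data.Nat using (_!)
open import Data.Nat.Properties using (_!≢0)
open import Data.Product using (∃)
open import Relation.Binary.PropositionalEquality using (_≡_)
open import Data.Nat.Properties using (_≟_)
open import Data.Integer as ℤ using (ℤ)
open import Data.Rational as ℚ using (ℚ; 0ℚ; 1ℚ; _+_; _*_; -_)
open import Relation.Nullary.Decidable using (does)
open import Data.Bool using (if_then_else_)

φ : ℕ → ℕ
φ M = go M
  where
  go : ℕ → ℕ
  go zero = 0
  go (suc i) = (if does (gcd (suc i) M ≟ 1) then 1 else 0) ℕ.+ go i

Σ< : ℕ → (ℕ → ℚ) → ℚ
Σ< zero f = 0ℚ
Σ< (suc n) f = Σ< n f + f n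

-- formal power series in t over ℚ, as coefficient sequences
Series : Set
Series = ℕ → ℚ

_⊛_ : Series → Series → Series
(f ⊛ g) n = Σ< (suc n) (λ i → f i * g (n ℕ.∸ i))

oneS : Series
oneS zero = 1ℚ
oneS (suc n) = 0ℚ

_^S_ : Series → ℕ → Series
f ^S zero = oneS
f ^S suc j = f ⊛ (f ^S j)

sgn : ℕ → ℚ
sgn zero = 1ℚ
sgn (suc n) = - sgn n

inv! : ℕ → ℚ
inv! n = ℤ.+ 1 ℚ./ (n !)
  where instance _ = n !≢0

oneMinusExpNeg : Series
oneMinusExpNeg zero = 0ℚ
oneMinusExpNeg (suc n) = - (sgn (suc n) * inv! (suc n))

-- Li_{-k}(x)/x = Σ_{m≥1} m^k x^{m-1}; with x = 1 - e^{-t} the summand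
-- for m has t-order ≥ m-1, so the coefficient of t^n only involves m ≤ n+1.
-- Coefficient of t^n in Li_{-k}(1-e^{-t})/(1-e^{-t}):
liCoeff : ℕ → ℕ → ℚ
liCoeff k n = Σ< (suc n) (λ j → ((ℤ.+ ((suc j) ℕ.^ k)) ℚ./ 1) * ((oneMinusExpNeg ^S j) n))

-- poly-Bernoulli number with negative upper index:  polyB k n = B_n^{(-k)}
polyB : ℕ → ℕ → ℚ
polyB k n = (ℤ.+ (n !) ℚ./ 1) * liCoeff k n

_≡_[modℚ_] : ℚ → ℚ → ℕ → Set
a ≡ b [modℚ M ] = ∃ λ (z : ℤ) → a ℚ.- b ≡ (ℤ.+ M ℤ.* z) ℚ./ 1

{-# OPTIONS --safe #-}
module Submission where

-- Write B_k^(-m) = Σ_{j ≤ k} (j+1)^m A j k, where A j k = k! [tᵏ] (1 - e⁻ᵗ)ʲ is an integer array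
-- with A (j+1) (k+1) = (j+1) (A j k - A (j+1) k); all the work is done on this integer form.
-- Duality B_k^(-m) = B_m^(-k), which makes the first congruence an equality: the m-th forward
-- difference in m plus the k-th forward difference in k of B, minus B, telescopes to [m = k = 0].
-- Each difference is its top value plus values at smaller m + k, so symmetry follows by
-- induction on m + k.
-- Vanishing: B_{k+1}^(-e) = G (e+1) - G e for G e = Σ_j (A j k - A (j+1) k) (j+2)^e, so the sum
-- over n ≤ e < n + φ(M) is Σ_j (A j k - A (j+1) k) ((j+2)^(n+φ(M)) - (j+2)^n). And
-- a^(n+φ(M)) ≡ a^n (mod M) for every a: split M = m₁ m₂ with m₁ the prime powers p^e ∥ M for
-- which p ∣ a, so that m₁ ∣ a^n since e ≤ n, and apply Euler's theorem to a + m₂.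

open import Algebra.Bundles using (CommutativeRing)
open import Defs

module FiniteSum {c ℓ} (R : CommutativeRing c ℓ) where

  open import Data.Nat using (ℕ; zero; suc; _≤_; _<_; z≤n; s≤s)
  import Data.Nat.Properties as ℕP
  open import Data.Sum using (inj₁; inj₂)
  import Relation.Binary.PropositionalEquality as ≡

  open CommutativeRing R
  open import Algebra.Properties.Ring ring using (-0#≈0#; -‿+-comm)
  open import Algebra.Properties.CommutativeSemigroup +-commutativeSemigroup using (interchange)
  open import Relation.Binary.Reasoning.Setoid setoid

  Σ : ℕ → (ℕ → Carrier) → Carrier
  Σ zero    f = 0#
  Σ (suc n) f = Σ n f + f n

  Σ-cong-< : ∀ n {f g : ℕ → Carrier} → (∀ i → i < n → f i ≈ g i) → Σ n f ≈ Σ n g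
  Σ-cong-< zero    f≈g = refl
  Σ-cong-< (suc n) f≈g = +-cong (Σ-cong-< n (λ i i<n → f≈g i (ℕP.m<n⇒m<1+n i<n))) (f≈g n ℕP.≤-refl)

  Σ-cong : ∀ n {f g : ℕ → Carrier} → (∀ i → f i ≈ g i) → Σ n f ≈ Σ n g
  Σ-cong n f≈g = Σ-cong-< n (λ i _ → f≈g i)

  Σ-zero : ∀ n {f : ℕ → Carrier} → (∀ i → i < n → f i ≈ 0#) → Σ n f ≈ 0#
  Σ-zero zero    f≈0 = refl
  Σ-zero (suc n) {f} f≈0 = begin
    Σ n f + f n ≈⟨ +-cong (Σ-zero n (λ i i<n → f≈0 i (ℕP.m<n⇒m<1+n i<n))) (f≈0 n ℕP.≤-refl) ⟩
    0# + 0#     ≈⟨ +-identityʳ 0# ⟩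
    0#          ∎

  Σ-extend : ∀ {n} m {f : ℕ → Carrier} → n ≤ m → (∀ i → n ≤ i → f i ≈ 0#) → Σ m f ≈ Σ n f
  Σ-extend zero    z≤n   f≈0 = refl
  Σ-extend {n} (suc m) {f} n≤1+m f≈0 with ℕP.m≤n⇒m<n∨m≡n n≤1+m
  ... | inj₂ ≡.refl    = refl
  ... | inj₁ (s≤s n≤m) = begin
    Σ m f + f m ≈⟨ +-cong (Σ-extend m n≤m f≈0) (f≈0 m n≤m) ⟩
    Σ n f + 0#  ≈⟨ +-identityʳ (Σ n f) ⟩
    Σ n f       ∎

  Σ-distrib-+ : ∀ n (f g : ℕ → Carrier) → Σ n (λ i → f i + g i) ≈ Σ n f + Σ n g
  Σ-distrib-+ zero    f g = sym (+-identityʳ 0#)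
  Σ-distrib-+ (suc n) f g = begin
    Σ n (λ i → f i + g i) + (f n + g n) ≈⟨ +-congʳ (Σ-distrib-+ n f g) ⟩
    (Σ n f + Σ n g) + (f n + g n)       ≈⟨ interchange _ _ _ _ ⟩
    (Σ n f + f n) + (Σ n g + g n)       ∎

  Σ-distrib-neg : ∀ n (f : ℕ → Carrier) → Σ n (λ i → - f i) ≈ - Σ n f
  Σ-distrib-neg zero    f = sym -0#≈0#
  Σ-distrib-neg (suc n) f = trans (+-congʳ (Σ-distrib-neg n f)) (-‿+-comm (Σ n f) (f n))

  Σ-distrib-- : ∀ n (f g : ℕ → Carrier) → Σ n (λ i → f i - g i) ≈ Σ n f - Σ n g
  Σ-distrib-- n f g = trans (Σ-distrib-+ n f (λ i → - g i)) (+-congˡ (Σ-distrib-neg n g))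

  *-distribˡ-Σ : ∀ n x (f : ℕ → Carrier) → x * Σ n f ≈ Σ n (λ i → x * f i)
  *-distribˡ-Σ zero    x f = zeroʳ x
  *-distribˡ-Σ (suc n) x f = trans (distribˡ x (Σ n f) (f n)) (+-congʳ (*-distribˡ-Σ n x f))

  Σ-suc : ∀ n (f : ℕ → Carrier) → Σ (suc n) f ≈ f 0 + Σ n (λ i → f (suc i))
  Σ-suc zero    f = trans (+-identityˡ (f 0)) (sym (+-identityʳ (f 0)))
  Σ-suc (suc n) f = trans (+-congʳ (Σ-suc n f)) (+-assoc (f 0) _ _)

  Σ-telescope : ∀ n (f : ℕ → Carrier) → Σ n (λ i → f (suc i) - f i) ≈ f n - f 0
  Σ-telescope zero    f = sym (-‿inverseʳ (f 0))
  Σ-telescope (suc n) f = begin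
    Σ n (λ i → f (suc i) - f i) + (f (suc n) - f n) ≈⟨ +-congʳ (Σ-telescope n f) ⟩
    (f n - f 0) + (f (suc n) - f n)                 ≈⟨ +-comm _ _ ⟩
    (f (suc n) - f n) + (f n - f 0)                 ≈⟨ +-assoc _ _ _ ⟩
    f (suc n) + (- f n + (f n - f 0))               ≈⟨ +-congˡ (sym (+-assoc _ _ _)) ⟩
    f (suc n) + ((- f n + f n) - f 0)               ≈⟨ +-congˡ (+-congʳ (-‿inverseˡ (f n))) ⟩
    f (suc n) + (0# - f 0)                          ≈⟨ +-congˡ (+-identityˡ _) ⟩
    f (suc n) - f 0                                 ∎

module FiniteDifferences where

  open import Data.Nat using (ℕ; zero; suc; _≤_; _<_; z≤n; s≤s)
  import Data.Nat.Properties as ℕP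
  open import Data.Integer as ℤ using (ℤ; +_; 0ℤ; 1ℤ; _+_; _*_; _-_; -_; _^_)
  import Data.Integer.Properties as ℤP
  open import Data.Integer.Tactic.RingSolver using (solve-∀)
  open import Relation.Binary.PropositionalEquality

  open FiniteSum ℤP.+-*-commutativeRing

  Δ : (ℕ → ℤ) → ℕ → ℤ
  Δ f a = f (suc a) - f a

  Δ^ : ℕ → (ℕ → ℤ) → ℕ → ℤ
  Δ^ zero    f = f
  Δ^ (suc m) f = Δ^ m (Δ f)

  Δ^-cong-≤ : ∀ m {f g : ℕ → ℤ} → (∀ b → b ≤ m → f b ≡ g b) → Δ^ m f 0 ≡ Δ^ m g 0
  Δ^-cong-≤ zero    f≡g = f≡g 0 z≤n
  Δ^-cong-≤ (suc m) f≡g =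
    Δ^-cong-≤ m (λ b b≤m → cong₂ _-_ (f≡g (suc b) (s≤s b≤m)) (f≡g b (ℕP.m≤n⇒m≤1+n b≤m)))

  Δ^-cong : ∀ m {f g : ℕ → ℤ} → (∀ b → f b ≡ g b) → Δ^ m f 0 ≡ Δ^ m g 0
  Δ^-cong m f≡g = Δ^-cong-≤ m (λ b _ → f≡g b)

  Δ^-*ˡ : ∀ m x (f : ℕ → ℤ) → Δ^ m (λ b → x * f b) 0 ≡ x * Δ^ m f 0
  Δ^-*ˡ zero    x f = refl
  Δ^-*ˡ (suc m) x f = trans (Δ^-cong m (λ b → factor x (f (suc b)) (f b))) (Δ^-*ˡ m x (Δ f))
    where
    factor : ∀ x y z → x * y - x * z ≡ x * (y - z)
    factor = solve-∀

  Δ^-distrib-- : ∀ m (f g : ℕ → ℤ) → Δ^ m (λ b → f b - g b) 0 ≡ Δ^ m f 0 - Δ^ m g 0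
  Δ^-distrib-- zero    f g = refl
  Δ^-distrib-- (suc m) f g =
    trans (Δ^-cong m (λ b → regroup (f (suc b)) (g (suc b)) (f b) (g b))) (Δ^-distrib-- m (Δ f) (Δ g))
    where
    regroup : ∀ x y z w → (x - y) - (z - w) ≡ (x - z) - (y - w)
    regroup = solve-∀

  Δ^-Σ : ∀ m n (g : ℕ → ℕ → ℤ) → Δ^ m (λ b → Σ n (λ j → g j b)) 0 ≡ Σ n (λ j → Δ^ m (g j) 0)
  Δ^-Σ zero    n g = refl
  Δ^-Σ (suc m) n g =
    trans (Δ^-cong m (λ b → sym (Σ-distrib-- n (λ j → g j (suc b)) (λ j → g j b)))) (Δ^-Σ m n (λ j → Δ (g j)))

  Δ^-pow : ∀ m x → Δ^ m (x ^_) 0 ≡ (x - 1ℤ) ^ m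
  Δ^-pow zero    x = refl
  Δ^-pow (suc m) x = begin
    Δ^ m (Δ (x ^_)) 0              ≡⟨ Δ^-cong m (λ b → factor x (x ^ b)) ⟩
    Δ^ m (λ b → (x - 1ℤ) * x ^ b) 0 ≡⟨ Δ^-*ˡ m (x - 1ℤ) (x ^_) ⟩
    (x - 1ℤ) * Δ^ m (x ^_) 0        ≡⟨ cong ((x - 1ℤ) *_) (Δ^-pow m x) ⟩
    (x - 1ℤ) * (x - 1ℤ) ^ m         ∎
    where
    open ≡-Reasoning
    factor : ∀ x y → x * y - y ≡ (x - 1ℤ) * y
    factor = solve-∀

  Δ^-vanishing : ∀ m {f : ℕ → ℤ} → (∀ b → b < m → f b ≡ 0ℤ) → Δ^ m f 0 ≡ f m
  Δ^-vanishing zero    f≡0 = refl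
  Δ^-vanishing (suc m) {f} f≡0 = begin
    Δ^ m (Δ f) 0        ≡⟨ Δ^-vanishing m (λ b b<m → cong₂ _-_ (f≡0 (suc b) (s≤s b<m)) (f≡0 b (ℕP.m<n⇒m<1+n b<m))) ⟩
    f (suc m) - f m     ≡⟨ cong (λ z → f (suc m) - z) (f≡0 m ℕP.≤-refl) ⟩
    f (suc m) - 0ℤ      ≡⟨ ℤP.+-identityʳ (f (suc m)) ⟩
    f (suc m)           ∎
    where open ≡-Reasoning

  Δ^< : ℕ → (ℕ → ℤ) → ℤ
  Δ^< m f = Δ^ m f 0 - f m

  Δ^<-cong : ∀ m {f g : ℕ → ℤ} → (∀ b → b < m → f b ≡ g b) → Δ^< m f ≡ Δ^< m g
  Δ^<-cong m {f} {g} f≡g = begin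
    Δ^ m f 0 - f m                             ≡⟨ shift (Δ^ m f 0) (Δ^ m g 0) (f m) (g m) ⟩
    (Δ^ m f 0 - Δ^ m g 0) - (f m - g m) + (Δ^ m g 0 - g m)
      ≡⟨ cong (λ d → d - (f m - g m) + (Δ^ m g 0 - g m)) difference ⟩
    (f m - g m) - (f m - g m) + (Δ^ m g 0 - g m) ≡⟨ cancel (f m - g m) (Δ^ m g 0 - g m) ⟩
    Δ^ m g 0 - g m                             ∎
    where
    open ≡-Reasoning
    difference : Δ^ m f 0 - Δ^ m g 0 ≡ f m - g m
    difference = begin
      Δ^ m f 0 - Δ^ m g 0      ≡⟨ Δ^-distrib-- m f g ⟨
      Δ^ m (λ b → f b - g b) 0 ≡⟨ Δ^-vanishing m (λ b b<m → trans (cong (_- g b) (f≡g b b<m)) (ℤP.+-inverseʳ (g b))) ⟩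
      f m - g m                ∎
    shift : ∀ x y z w → x - z ≡ (x - y) - (z - w) + (y - w)
    shift = solve-∀
    cancel : ∀ d r → d - d + r ≡ r
    cancel = solve-∀

module IntegerPolyBernoulli where

  open import Data.Nat as ℕ using (ℕ; zero; suc; _≤_; _<_; s≤s)
  import Data.Nat.Properties as ℕP
  open import Data.Integer as ℤ using (ℤ; +_; 0ℤ; 1ℤ; _+_; _*_; _-_; -_; _^_)
  import Data.Integer.Properties as ℤP
  open import Data.Integer.Tactic.RingSolver using (solve-∀)
  open import Relation.Binary.PropositionalEquality
  open import Data.Integer.Divisibility.Signed as ℤ∣ using (divides)

  open FiniteSum ℤP.+-*-commutativeRing
  open FiniteDifferences

  -- The recursion is the coefficient form of (d/dt) (1 - e⁻ᵗ)ʲ⁺¹ = (j+1) ((1 - e⁻ᵗ)ʲ - (1 - e⁻ᵗ)ʲ⁺¹).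
  A : ℕ → ℕ → ℤ
  A zero    zero    = 1ℤ
  A (suc j) zero    = 0ℤ
  A zero    (suc k) = 0ℤ
  A (suc j) (suc k) = + suc j * (A j k - A (suc j) k)

  A-vanish : ∀ {j k} → k < j → A j k ≡ 0ℤ
  A-vanish {suc j} {zero}  _         = refl
  A-vanish {suc j} {suc k} (s≤s k<j) = begin
    + suc j * (A j k - A (suc j) k) ≡⟨ cong₂ (λ x y → + suc j * (x - y)) (A-vanish k<j) (A-vanish (ℕP.m<n⇒m<1+n k<j)) ⟩
    + suc j * 0ℤ                    ≡⟨ ℤP.*-zeroʳ (+ suc j) ⟩
    0ℤ                              ∎
    where open ≡-Reasoning

  Δ^-A : ∀ k j → Δ^ k (A j) 0 ≡ A j k - A (suc j) k
  Δ^-A zero    zero    = refl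
  Δ^-A zero    (suc j) = refl
  Δ^-A (suc k) zero    = begin
    Δ^ k (Δ (A 0)) 0               ≡⟨ Δ^-cong k (λ b → negate (A 0 b)) ⟩
    Δ^ k (λ b → - 1ℤ * A 0 b) 0    ≡⟨ Δ^-*ˡ k (- 1ℤ) (A 0) ⟩
    - 1ℤ * Δ^ k (A 0) 0            ≡⟨ cong (- 1ℤ *_) (Δ^-A k 0) ⟩
    - 1ℤ * (A 0 k - A 1 k)         ≡⟨ negate′ (A 0 k - A 1 k) ⟩
    0ℤ - 1ℤ * (A 0 k - A 1 k)      ∎
    where
    open ≡-Reasoning
    negate : ∀ x → 0ℤ - x ≡ - 1ℤ * x
    negate = solve-∀
    negate′ : ∀ x → - 1ℤ * x ≡ 0ℤ - 1ℤ * x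
    negate′ = solve-∀
  Δ^-A (suc k) (suc j) = begin
    Δ^ k (Δ (A (suc j))) 0
      ≡⟨ Δ^-cong k (λ b → split (+ suc j) (A j b) (A (suc j) b)) ⟩
    Δ^ k (λ b → + suc j * A j b - (+ suc (suc j)) * A (suc j) b) 0
      ≡⟨ Δ^-distrib-- k _ _ ⟩
    Δ^ k (λ b → + suc j * A j b) 0 - Δ^ k (λ b → + suc (suc j) * A (suc j) b) 0
      ≡⟨ cong₂ _-_ (Δ^-*ˡ k (+ suc j) (A j)) (Δ^-*ˡ k (+ suc (suc j)) (A (suc j))) ⟩
    + suc j * Δ^ k (A j) 0 - + suc (suc j) * Δ^ k (A (suc j)) 0
      ≡⟨ cong₂ (λ x y → + suc j * x - + suc (suc j) * y) (Δ^-A k j) (Δ^-A k (suc j)) ⟩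
    + suc j * (A j k - A (suc j) k) - + suc (suc j) * (A (suc j) k - A (suc (suc j)) k)
      ≡⟨⟩
    A (suc j) (suc k) - A (suc (suc j)) (suc k) ∎
    where
    open ≡-Reasoning
    split : ∀ n x y → n * (x - y) - y ≡ n * x - (1ℤ + n) * y
    split = solve-∀

  polyBℤ : ℕ → ℕ → ℤ
  polyBℤ m k = Σ (suc k) (λ j → (+ suc j) ^ m * A j k)

  polyBℤ-extend : ∀ {n} m k → k < n → Σ n (λ j → (+ suc j) ^ m * A j k) ≡ polyBℤ m k
  polyBℤ-extend m k k<n = Σ-extend _ k<n (λ j k<j → trans (cong ((+ suc j) ^ m *_) (A-vanish k<j)) (ℤP.*-zeroʳ ((+ suc j) ^ m)))

  Δ^-polyBℤ-upper : ∀ m k → Δ^ m (λ a → polyBℤ a k) 0 ≡ Σ (suc k) (λ j → (+ j) ^ m * A j k)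
  Δ^-polyBℤ-upper m k = trans (Δ^-Σ m (suc k) (λ j a → (+ suc j) ^ a * A j k)) (Σ-cong (suc k) term)
    where
    open ≡-Reasoning
    term : ∀ j → Δ^ m (λ a → (+ suc j) ^ a * A j k) 0 ≡ (+ j) ^ m * A j k
    term j = begin
      Δ^ m (λ a → (+ suc j) ^ a * A j k) 0 ≡⟨ Δ^-cong m (λ a → ℤP.*-comm ((+ suc j) ^ a) (A j k)) ⟩
      Δ^ m (λ a → A j k * (+ suc j) ^ a) 0 ≡⟨ Δ^-*ˡ m (A j k) ((+ suc j) ^_) ⟩
      A j k * Δ^ m ((+ suc j) ^_) 0        ≡⟨ cong (A j k *_) (Δ^-pow m (+ suc j)) ⟩
      A j k * (+ suc j - 1ℤ) ^ m           ≡⟨⟩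
      A j k * (+ j) ^ m                    ≡⟨ ℤP.*-comm (A j k) ((+ j) ^ m) ⟩
      (+ j) ^ m * A j k                    ∎

  Δ^-polyBℤ-lower : ∀ m k → Δ^ k (polyBℤ m) 0 ≡ Σ (suc k) (λ j → (+ suc j) ^ m * (A j k - A (suc j) k))
  Δ^-polyBℤ-lower m k = begin
    Δ^ k (polyBℤ m) 0
      ≡⟨ Δ^-cong-≤ k (λ b b≤k → sym (polyBℤ-extend m b (s≤s b≤k))) ⟩
    Δ^ k (λ b → Σ (suc k) (λ j → (+ suc j) ^ m * A j b)) 0
      ≡⟨ Δ^-Σ k (suc k) (λ j b → (+ suc j) ^ m * A j b) ⟩
    Σ (suc k) (λ j → Δ^ k (λ b → (+ suc j) ^ m * A j b) 0)
      ≡⟨ Σ-cong (suc k) (λ j → trans (Δ^-*ˡ k ((+ suc j) ^ m) (A j)) (cong ((+ suc j) ^ m *_) (Δ^-A k j))) ⟩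
    Σ (suc k) (λ j → (+ suc j) ^ m * (A j k - A (suc j) k)) ∎
    where open ≡-Reasoning

  corner : ℕ → ℕ → ℤ
  corner m k = (+ 0) ^ m * A 0 k

  corner-sym : ∀ m k → corner m k ≡ corner k m
  corner-sym zero    zero    = refl
  corner-sym zero    (suc k) = refl
  corner-sym (suc m) zero    = refl
  corner-sym (suc m) (suc k) = refl

  Δ^-polyBℤ-both : ∀ m k → Δ^ m (λ a → polyBℤ a k) 0 + Δ^ k (polyBℤ m) 0 - polyBℤ m k ≡ corner m k
  Δ^-polyBℤ-both m k = begin
    Δ^ m (λ a → polyBℤ a k) 0 + Δ^ k (polyBℤ m) 0 - polyBℤ m k
      ≡⟨ cong₂ (λ x y → x + y - polyBℤ m k) (Δ^-polyBℤ-upper m k) (Δ^-polyBℤ-lower m k) ⟩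
    Σ (suc k) (λ j → (+ j) ^ m * A j k) + Σ (suc k) (λ j → (+ suc j) ^ m * (A j k - A (suc j) k)) - polyBℤ m k
      ≡⟨ cong (_- polyBℤ m k) (Σ-distrib-+ (suc k) _ _) ⟨
    Σ (suc k) (λ j → (+ j) ^ m * A j k + (+ suc j) ^ m * (A j k - A (suc j) k)) - polyBℤ m k
      ≡⟨ Σ-distrib-- (suc k) _ _ ⟨
    Σ (suc k) (λ j → (+ j) ^ m * A j k + (+ suc j) ^ m * (A j k - A (suc j) k) - (+ suc j) ^ m * A j k)
      ≡⟨ Σ-cong (suc k) (λ j → cancel ((+ j) ^ m) ((+ suc j) ^ m) (A j k) (A (suc j) k)) ⟩
    Σ (suc k) (λ j → - (h (suc j) - h j))
      ≡⟨ Σ-distrib-neg (suc k) (λ j → h (suc j) - h j) ⟩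
    - Σ (suc k) (λ j → h (suc j) - h j)
      ≡⟨ cong -_ (Σ-telescope (suc k) h) ⟩
    - (h (suc k) - h 0)
      ≡⟨ cong (λ x → - ((+ suc k) ^ m * x - h 0)) (A-vanish {j = suc k} ℕP.≤-refl) ⟩
    - ((+ suc k) ^ m * 0ℤ - h 0)
      ≡⟨ vanish ((+ suc k) ^ m) (h 0) ⟩
    corner m k ∎
    where
    open ≡-Reasoning
    h : ℕ → ℤ
    h j = (+ j) ^ m * A j k
    cancel : ∀ p q a b → p * a + q * (a - b) - q * a ≡ - (q * b - p * a)
    cancel = solve-∀
    vanish : ∀ q x → - (q * 0ℤ - x) ≡ x
    vanish = solve-∀

  polyBℤ-recurrence : ∀ m k → polyBℤ m k ≡ corner m k - Δ^< m (λ a → polyBℤ a k) - Δ^< k (polyBℤ m)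
  polyBℤ-recurrence m k = begin
    polyBℤ m k                     ≡⟨ isolate (Δ^ m (λ a → polyBℤ a k) 0) (Δ^ k (polyBℤ m) 0) (polyBℤ m k) ⟩
    (x + y - p) - (x - p) - (y - p) ≡⟨ cong (λ c → c - (x - p) - (y - p)) (Δ^-polyBℤ-both m k) ⟩
    corner m k - (x - p) - (y - p)  ∎
    where
    open ≡-Reasoning
    x = Δ^ m (λ a → polyBℤ a k) 0
    y = Δ^ k (polyBℤ m) 0
    p = polyBℤ m k
    isolate : ∀ x y p → p ≡ (x + y - p) - (x - p) - (y - p)
    isolate = solve-∀

  polyBℤ-dual : ∀ m k → polyBℤ m k ≡ polyBℤ k m
  polyBℤ-dual m k = bounded (m ℕ.+ k) m k ℕP.≤-refl
    where
    bounded : ∀ s m k → m ℕ.+ k ≤ s → polyBℤ m k ≡ polyBℤ k m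
    bounded zero    zero    zero    _       = refl
    bounded zero    zero    (suc _) ()
    bounded zero    (suc _) _       ()
    bounded (suc s) m       k       m+k≤1+s = begin
      polyBℤ m k
        ≡⟨ polyBℤ-recurrence m k ⟩
      corner m k - Δ^< m (λ a → polyBℤ a k) - Δ^< k (polyBℤ m)
        ≡⟨ cong₂ _-_ (cong₂ _-_ (corner-sym m k) (Δ^<-cong m (λ a a<m → bounded s a k (lower-left a<m))))
                     (Δ^<-cong k (λ b b<k → bounded s m b (lower-right b<k))) ⟩
      corner k m - Δ^< m (polyBℤ k) - Δ^< k (λ b → polyBℤ b m)
        ≡⟨ swap-subtrahends (corner k m) _ _ ⟩
      corner k m - Δ^< k (λ b → polyBℤ b m) - Δ^< m (polyBℤ k)
        ≡⟨ polyBℤ-recurrence k m ⟨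
      polyBℤ k m ∎
      where
      open ≡-Reasoning
      lower-left : ∀ {a} → a < m → a ℕ.+ k ≤ s
      lower-left a<m = ℕP.≤-pred (ℕP.≤-trans (ℕP.+-monoˡ-< k a<m) m+k≤1+s)
      lower-right : ∀ {b} → b < k → m ℕ.+ b ≤ s
      lower-right b<k = ℕP.≤-pred (ℕP.≤-trans (ℕP.+-monoʳ-< m b<k) m+k≤1+s)
      swap-subtrahends : ∀ c x y → c - x - y ≡ c - y - x
      swap-subtrahends = solve-∀

  antidifference : ℕ → ℕ → ℤ
  antidifference k e = Σ (suc k) (λ j → (A j k - A (suc j) k) * (+ suc (suc j)) ^ e)

  polyBℤ-suc : ∀ e k → polyBℤ e (suc k) ≡ antidifference k (suc e) - antidifference k e
  polyBℤ-suc e k = begin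
    Σ (suc (suc k)) (λ j → (+ suc j) ^ e * A j (suc k))
      ≡⟨ Σ-suc (suc k) (λ j → (+ suc j) ^ e * A j (suc k)) ⟩
    (+ 1) ^ e * 0ℤ + Σ (suc k) (λ j → (+ suc (suc j)) ^ e * A (suc j) (suc k))
      ≡⟨ cong (_+ Σ (suc k) (λ j → (+ suc (suc j)) ^ e * A (suc j) (suc k))) (ℤP.*-zeroʳ ((+ 1) ^ e)) ⟩
    0ℤ + Σ (suc k) (λ j → (+ suc (suc j)) ^ e * A (suc j) (suc k))
      ≡⟨ ℤP.+-identityˡ _ ⟩
    Σ (suc k) (λ j → (+ suc (suc j)) ^ e * A (suc j) (suc k))
      ≡⟨ Σ-cong (suc k) (λ j → spread ((+ suc (suc j)) ^ e) (+ suc j) (A j k - A (suc j) k)) ⟩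
    Σ (suc k) (λ j → (A j k - A (suc j) k) * (+ suc (suc j) * (+ suc (suc j)) ^ e)
                   - (A j k - A (suc j) k) * (+ suc (suc j)) ^ e)
      ≡⟨ Σ-distrib-- (suc k) _ _ ⟩
    antidifference k (suc e) - antidifference k e ∎
    where
    open ≡-Reasoning
    spread : ∀ q n f → q * (n * f) ≡ f * ((1ℤ + n) * q) - f * q
    spread = solve-∀

  Σ-polyBℤ-suc : ∀ n N k → Σ N (λ i → polyBℤ (n ℕ.+ i) (suc k))
    ≡ Σ (suc k) (λ j → (A j k - A (suc j) k) * ((+ suc (suc j)) ^ (n ℕ.+ N) - (+ suc (suc j)) ^ n))
  Σ-polyBℤ-suc n N k = begin
    Σ N (λ i → polyBℤ (n ℕ.+ i) (suc k))
      ≡⟨ Σ-cong N (λ i → trans (polyBℤ-suc (n ℕ.+ i) k) (cong (λ e → antidifference k e - antidifference k (n ℕ.+ i)) (sym (ℕP.+-suc n i)))) ⟩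
    Σ N (λ i → antidifference k (n ℕ.+ suc i) - antidifference k (n ℕ.+ i))
      ≡⟨ Σ-telescope N (λ i → antidifference k (n ℕ.+ i)) ⟩
    antidifference k (n ℕ.+ N) - antidifference k (n ℕ.+ 0)
      ≡⟨ cong (λ e → antidifference k (n ℕ.+ N) - antidifference k e) (ℕP.+-identityʳ n) ⟩
    antidifference k (n ℕ.+ N) - antidifference k n
      ≡⟨ Σ-distrib-- (suc k) _ _ ⟨
    Σ (suc k) (λ j → (A j k - A (suc j) k) * (+ suc (suc j)) ^ (n ℕ.+ N) - (A j k - A (suc j) k) * (+ suc (suc j)) ^ n)
      ≡⟨ Σ-cong (suc k) (λ j → factor (A j k - A (suc j) k) _ _) ⟩
    Σ (suc k) (λ j → (A j k - A (suc j) k) * ((+ suc (suc j)) ^ (n ℕ.+ N) - (+ suc (suc j)) ^ n)) ∎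
    where
    open ≡-Reasoning
    factor : ∀ f x y → f * x - f * y ≡ f * (x - y)
    factor = solve-∀

  ∣-Σ : ∀ {m} n (f : ℕ → ℤ) → (∀ i → i < n → + m ℤ∣.∣ f i) → + m ℤ∣.∣ Σ n f
  ∣-Σ zero    f m∣f = divides 0ℤ refl
  ∣-Σ (suc n) f m∣f = ℤ∣.∣m∣n⇒∣m+n (∣-Σ n f (λ i i<n → m∣f i (ℕP.m<n⇒m<1+n i<n))) (m∣f n ℕP.≤-refl)

  ∣-Σ-polyBℤ-suc : ∀ {m} n N k → (∀ a → + m ℤ∣.∣ (+ a) ^ (n ℕ.+ N) - (+ a) ^ n) →
    + m ℤ∣.∣ Σ N (λ i → polyBℤ (n ℕ.+ i) (suc k))
  ∣-Σ-polyBℤ-suc n N k periodic = subst (_ ℤ∣.∣_) (sym (Σ-polyBℤ-suc n N k))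
    (∣-Σ (suc k) _ (λ j _ → ℤ∣.∣n⇒∣m*n (A j k - A (suc j) k) (periodic (suc (suc j)))))

module Congruences where

  open import Data.Nat as ℕ using (ℕ; zero; suc; _≤_; _<_; z≤n; s≤s; _∸_; _%_; _/_; NonZero)
  import Data.Nat.Properties as ℕP
  open import Data.Nat.DivMod using (m≡m%n+[m/n]*n; m%n<n)
  open import Data.Nat.Divisibility as ℕ∣ using (divides; _∣?_)
  open import Data.Nat.Coprimality as Coprime using (Coprime; coprime?)
  open import Data.Nat.GCD using (gcd)
  open import Data.Nat.ListAction using (product)
  open import Data.Nat.ListAction.Properties using (product-↭)
  open import Data.Integer as ℤ using (ℤ; +_; 0ℤ; 1ℤ; _+_; _*_; _-_; -_; _^_)
  import Data.Integer.Properties as ℤP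
  open import Data.Integer.Divisibility.Signed as ℤ∣ using (divides)
  open import Data.Integer.Tactic.RingSolver using (solve-∀)
  open import Data.List using (List; []; _∷_; _++_; map; length; filter; applyDownFrom)
  open import Data.List.Properties using (length-map)
  open import Data.List.Membership.Propositional using (_∈_)
  open import Data.List.Membership.Propositional.Properties using (∈-∃++; ∈-filter⁻; ∈-filter⁺; ∈-applyDownFrom⁻; ∈-applyDownFrom⁺; ∈-map⁻)
  open import Data.List.Relation.Binary.Subset.Propositional using (_⊆_)
  open import Data.List.Relation.Binary.Permutation.Propositional using (_↭_; ↭-refl; ↭-sym; ↭-trans; ↭-prep)
  open import Data.List.Relation.Binary.Permutation.Propositional.Properties using (shift; ∈-resp-↭; ↭-length)
  open import Data.List.Relation.Unary.All as All using (All; []; _∷_)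
  import Data.List.Relation.Unary.All.Properties as All
  open import Data.List.Relation.Unary.Any using (here; there)
  open import Data.List.Relation.Unary.Unique.Propositional using (Unique)
  import Data.List.Relation.Unary.Unique.Propositional.Properties as Unique
  open import Data.Bool using (true; false; if_then_else_)
  open import Relation.Nullary.Decidable using (does)
  open import Data.Product using (_×_; _,_; proj₁; proj₂)
  open import Data.Sum using ([_,_]′; inj₁; inj₂)
  open import Data.Nat.Primality using (Prime; prime⇒irreducible; ¬prime[1])
  open import Data.Nat.LCM using (lcm; lcm-least; gcd*lcm)
  open import Data.List.Relation.Unary.AllPairs using (AllPairs; []; _∷_)
  open import Relation.Nullary using (¬_; yes; no)
  open import Data.Empty using (⊥-elim)
  open import Relation.Binary.PropositionalEquality
  open import Function using (_∘_)
  open import Algebra.Properties.CommutativeSemigroup ℕP.*-commutativeSemigroup using () renaming (x∙yz≈y∙xz to ℕ-x∙yz≈y∙xz)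

  ⊆-unique-length⇒↭ : ∀ {A : Set} {xs ys : List A} → Unique xs → xs ⊆ ys → length ys ≤ length xs → xs ↭ ys
  ⊆-unique-length⇒↭ {xs = []}     {[]}    _ _ _  = ↭-refl
  ⊆-unique-length⇒↭ {xs = []}     {_ ∷ _} _ _ ()
  ⊆-unique-length⇒↭ {xs = x ∷ xs} {ys} (x∉xs ∷ unique) xs⊆ys |ys|≤ with ∈-∃++ (xs⊆ys (here refl))
  ... | as , bs , refl = ↭-trans (↭-prep x (⊆-unique-length⇒↭ unique xs⊆as++bs length-bound)) (↭-sym (shift x as bs))
    where
    xs⊆as++bs : xs ⊆ as ++ bs
    xs⊆as++bs z∈xs with ∈-resp-↭ (shift x as bs) (xs⊆ys (there z∈xs))
    ... | here refl = ⊥-elim (All.lookup x∉xs z∈xs refl)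
    ... | there z∈as++bs = z∈as++bs
    length-bound : length (as ++ bs) ≤ length xs
    length-bound = ℕP.≤-pred (subst (_≤ suc (length xs)) (↭-length (shift x as bs)) |ys|≤)

  map⁺-injectiveOn : ∀ {A B : Set} {f : A → B} {xs} → (∀ {x y} → x ∈ xs → y ∈ xs → f x ≡ f y → x ≡ y) →
    Unique xs → Unique (map f xs)
  map⁺-injectiveOn {xs = []}     inj []             = []
  map⁺-injectiveOn {xs = x ∷ xs} inj (x∉xs ∷ unique) =
    All.map⁺ (All.tabulate (λ y∈ fx≡fy → All.lookup x∉xs y∈ (inj (here refl) (there y∈) fx≡fy)))
    ∷ map⁺-injectiveOn (λ x∈ y∈ → inj (there x∈) (there y∈)) unique

  coprime-* : ∀ {a b m} → Coprime a m → Coprime b m → Coprime (a ℕ.* b) m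
  coprime-* {a} {b} {m} a⊥m b⊥m {d} (d∣ab , d∣m) = b⊥m (Coprime.coprime-divisor d⊥a d∣ab , d∣m)
    where
    d⊥a : Coprime d a
    d⊥a (i∣d , i∣a) = a⊥m (i∣a , ℕ∣.∣-trans i∣d d∣m)

  coprime-*ʳ : ∀ {m a b} → Coprime m a → Coprime m b → Coprime m (a ℕ.* b)
  coprime-*ʳ m⊥a m⊥b = Coprime.sym (coprime-* (Coprime.sym m⊥a) (Coprime.sym m⊥b))

  coprime-product : ∀ {m xs} → All (λ x → Coprime x m) xs → Coprime (product xs) m
  coprime-product {m} []            = Coprime.1-coprimeTo m
  coprime-product     (x⊥m ∷ xs⊥m) = coprime-* x⊥m (coprime-product xs⊥m)

  coprime-∣ʳ : ∀ {a m d} → Coprime a m → d ℕ∣.∣ m → Coprime a d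
  coprime-∣ʳ a⊥m d∣m (i∣a , i∣d) = a⊥m (i∣a , ℕ∣.∣-trans i∣d d∣m)

  ∣-cancel-coprime : ∀ {m c} z → Coprime c m → + m ℤ∣.∣ + c * z → + m ℤ∣.∣ z
  ∣-cancel-coprime {m} {c} z c⊥m m∣cz = ℤ∣.∣ᵤ⇒∣ (Coprime.coprime-divisor (Coprime.sym c⊥m)
    (subst (m ℕ∣.∣_) (ℤP.abs-* (+ c) z) (ℤ∣.∣⇒∣ᵤ m∣cz)))

  ∣-%-sub : ∀ m .{{_ : NonZero m}} t → + m ℤ∣.∣ + (t % m) - + t
  ∣-%-sub m t = divides (- + (t / m)) (begin
    + (t % m) - + t                                ≡⟨ cong (λ s → + (t % m) - s) t≡ ⟩
    + (t % m) - (+ (t % m) + + (t / m) * + m)  ≡⟨ cancel (+ (t % m)) (+ (t / m)) (+ m) ⟩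
    - + (t / m) * + m                            ∎)
    where
    open ≡-Reasoning
    t≡ : + t ≡ + (t % m) + + (t / m) * + m
    t≡ = trans (cong +_ (m≡m%n+[m/n]*n t m)) (trans (ℤP.pos-+ (t % m) (t / m ℕ.* m)) (cong (λ s → + (t % m) + s) (ℤP.pos-* (t / m) m)))
    cancel : ∀ r q m → r - (r + q * m) ≡ - q * m
    cancel = solve-∀

  ∣-∸⇒≤ : ∀ {m x y} → 1 ≤ x → x ≤ y → y ≤ m → m ℕ∣.∣ y ∸ x → y ≤ x
  ∣-∸⇒≤ {m} {x} {y} 1≤x x≤y y≤m m∣y∸x with y ∸ x in y∸x≡
  ... | zero  = ℕP.m∸n≡0⇒m≤n y∸x≡
  ... | suc _ = ⊥-elim (ℕ∣.>⇒∤ (subst (_< m) y∸x≡ (ℕP.<-≤-trans (ℕP.∸-monoʳ-< 1≤x x≤y) y≤m)) m∣y∸x)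

  ∣-distance⇒≡ : ∀ {m x y} → 1 ≤ x → x ≤ m → 1 ≤ y → y ≤ m → + m ℤ∣.∣ + x - + y → x ≡ y
  ∣-distance⇒≡ {m} {x} {y} 1≤x x≤m 1≤y y≤m m∣x-y = [ x≤y⇒x≡y , (λ y≤x → sym (y≤x⇒y≡x y≤x)) ]′ (ℕP.≤-total x y)
    where
    m∣ : m ℕ∣.∣ ℤ.∣ + x - + y ∣
    m∣ = ℤ∣.∣⇒∣ᵤ m∣x-y
    distance : ∀ {x y} → x ≤ y → ℤ.∣ + x - + y ∣ ≡ y ∸ x
    distance {x} {y} x≤y = trans (cong ℤ.∣_∣ (ℤP.[+m]-[+n]≡m⊖n x y)) (ℤP.∣⊖∣-≤ x≤y)
    x≤y⇒x≡y : x ≤ y → x ≡ y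
    x≤y⇒x≡y x≤y = ℕP.≤-antisym x≤y (∣-∸⇒≤ 1≤x x≤y y≤m (subst (m ℕ∣.∣_) (distance x≤y) m∣))
    y≤x⇒y≡x : y ≤ x → y ≡ x
    y≤x⇒y≡x y≤x = ℕP.≤-antisym y≤x (∣-∸⇒≤ 1≤y y≤x x≤m
      (subst (m ℕ∣.∣_) (trans (ℤP.∣i-j∣≡∣j-i∣ (+ x) (+ y)) (distance y≤x)) m∣))

  coprimesUpTo : ℕ → ℕ → ℕ
  coprimesUpTo m zero    = 0
  coprimesUpTo m (suc i) = (if does (gcd (suc i) m ℕP.≟ 1) then 1 else 0) ℕ.+ coprimesUpTo m i

  private
    coprimesUpTo-unique : ∀ {count : ℕ → ℕ → ℕ} → (∀ m → count m 0 ≡ 0) →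
      (∀ m i → count m (suc i) ≡ (if does (gcd (suc i) m ℕP.≟ 1) then 1 else 0) ℕ.+ count m i) →
      ∀ m i → count m i ≡ coprimesUpTo m i
    coprimesUpTo-unique count-zero count-suc m zero    = count-zero m
    coprimesUpTo-unique count-zero count-suc m (suc i) =
      trans (count-suc m i) (cong (_ ℕ.+_) (coprimesUpTo-unique count-zero count-suc m i))

  -- Defs.φ counts with a local function that cannot be named here; the metavariable
  -- φ-go is solved to it by unification, once abstracting `suc m` makes both of its
  -- arguments variables.
  mutual
    private
      φ-go : ℕ → ℕ → ℕ
      φ-go = _

    φ≡coprimesUpTo : ∀ m → φ m ≡ coprimesUpTo m m
    φ≡coprimesUpTo zero    = refl
    φ≡coprimesUpTo (suc m) with (if does (gcd (suc m) (suc m) ℕP.≟ 1) then 1 else 0)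
    ... | c with suc m
    ... | m′ = cong (c ℕ.+_) (coprimesUpTo-unique {φ-go} (λ _ → refl) (λ _ _ → refl) m′ m)

  units : ℕ → List ℕ
  units m = filter (λ x → coprime? x m) (applyDownFrom suc m)

  φ≡length-units : ∀ m → φ m ≡ length (units m)
  φ≡length-units m = trans (φ≡coprimesUpTo m) (counts m)
    where
    counts : ∀ i → coprimesUpTo m i ≡ length (filter (λ x → coprime? x m) (applyDownFrom suc i))
    counts zero = refl
    counts (suc i) with does (gcd (suc i) m ℕP.≟ 1)
    ... | true  = cong suc (counts i)
    ... | false = counts i

  ∈-units⁻ : ∀ {m x} → x ∈ units m → 1 ≤ x × x ≤ m × Coprime x m
  ∈-units⁻ {m} x∈ with ∈-filter⁻ (λ x → coprime? x m) {xs = applyDownFrom suc m} x∈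
  ... | x∈range , x⊥m with ∈-applyDownFrom⁻ suc x∈range
  ...   | i , i<m , refl = s≤s z≤n , i<m , x⊥m

  ∈-units⁺ : ∀ {m x} → 1 ≤ x → x ≤ m → Coprime x m → x ∈ units m
  ∈-units⁺ {m} {suc i} _ i<m x⊥m = ∈-filter⁺ (λ x → coprime? x m) (∈-applyDownFrom⁺ suc i<m) x⊥m

  units-unique : ∀ m → Unique (units m)
  units-unique m = Unique.filter⁺ (λ x → coprime? x m)
    (Unique.applyDownFrom⁺₁ suc m (λ j<i _ → ℕP.<⇒≢ (s≤s j<i) ∘ sym))

  ∣-product-map-% : ∀ m .{{_ : NonZero m}} b xs →
    + m ℤ∣.∣ + product (map (λ x → (b ℕ.* x) % m) xs) - (+ b) ^ length xs * + product xs
  ∣-product-map-% m b []       = divides 0ℤ refl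
  ∣-product-map-% m b (x ∷ xs) = subst (+ m ℤ∣.∣_) (sym expand)
    (ℤ∣.∣m∣n⇒∣m+n (ℤ∣.∣n⇒∣m*n (+ r) (∣-product-map-% m b xs))
                  (ℤ∣.∣n⇒∣m*n (B * P) (subst (λ t → + m ℤ∣.∣ + r - t) (ℤP.pos-* b x) (∣-%-sub m (b ℕ.* x)))))
    where
    r = (b ℕ.* x) % m
    R = + product (map (λ x → (b ℕ.* x) % m) xs)
    P = + product xs
    B = (+ b) ^ length xs
    regroup : ∀ r R b B x P → r * R - (b * B) * (x * P) ≡ r * (R - B * P) + B * P * (r - b * x)
    regroup = solve-∀
    expand : + (r ℕ.* product (map (λ x → (b ℕ.* x) % m) xs)) - (+ b) ^ suc (length xs) * + (x ℕ.* product xs)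
           ≡ + r * (R - B * P) + B * P * (+ r - + b * + x)
    expand = trans (cong₂ (λ s t → s - (+ b) ^ suc (length xs) * t) (ℤP.pos-* r _) (ℤP.pos-* x (product xs)))
                   (regroup (+ r) R (+ b) B (+ x) P)

  module _ {m b : ℕ} (2≤m : 2 ≤ m) (b⊥m : Coprime b m) where
    private
      instance
        m≢0 : NonZero m
        m≢0 = ℕ.>-nonZero (ℕP.<-trans (s≤s z≤n) 2≤m)

      mulMod : ℕ → ℕ
      mulMod x = (b ℕ.* x) % m

      mulMod-unit : ∀ {x} → x ∈ units m → mulMod x ∈ units m
      mulMod-unit {x} x∈ with ∈-units⁻ x∈
      ... | _ , _ , x⊥m = ∈-units⁺ positive (ℕP.<⇒≤ (m%n<n (b ℕ.* x) m)) r⊥m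
        where
        r⊥m : Coprime (mulMod x) m
        r⊥m (d∣r , d∣m) = coprime-* b⊥m x⊥m (ℕ∣.∣n∣m%n⇒∣m d∣m d∣r , d∣m)
        positive : 1 ≤ mulMod x
        positive with mulMod x in r≡
        ... | zero  = ⊥-elim (ℕP.<⇒≢ 2≤m (sym (r⊥m (subst (m ℕ∣.∣_) (sym r≡) (m ℕ∣.∣0) , ℕ∣.∣-refl))))
        ... | suc _ = s≤s z≤n

      mulMod-injective : ∀ {x y} → x ∈ units m → y ∈ units m → mulMod x ≡ mulMod y → x ≡ y
      mulMod-injective {x} {y} x∈ y∈ r≡ with ∈-units⁻ x∈ | ∈-units⁻ y∈
      ... | 1≤x , x≤m , _ | 1≤y , y≤m , _ = ∣-distance⇒≡ 1≤x x≤m 1≤y y≤m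
        (∣-cancel-coprime (+ x - + y) b⊥m (subst (+ m ℤ∣.∣_) regroup
          (ℤ∣.∣m∣n⇒∣m-n (subst (λ r → + m ℤ∣.∣ + r - + (b ℕ.* y)) (sym r≡) (∣-%-sub m (b ℕ.* y))) (∣-%-sub m (b ℕ.* x)))))
        where
        regroup : (+ mulMod x - + (b ℕ.* y)) - (+ mulMod x - + (b ℕ.* x)) ≡ + b * (+ x - + y)
        regroup = trans (cong₂ (λ s t → (+ mulMod x - s) - (+ mulMod x - t)) (ℤP.pos-* b y) (ℤP.pos-* b x))
                        (identity (+ mulMod x) (+ b) (+ x) (+ y))
          where
          identity : ∀ r b x y → (r - b * y) - (r - b * x) ≡ b * (x - y)
          identity = solve-∀

      mulMod-permutes : map mulMod (units m) ↭ units m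
      mulMod-permutes = ⊆-unique-length⇒↭ unique image⊆ (ℕP.≤-reflexive (sym (length-map mulMod (units m))))
        where
        unique : Unique (map mulMod (units m))
        unique = map⁺-injectiveOn mulMod-injective (units-unique m)
        image⊆ : map mulMod (units m) ⊆ units m
        image⊆ r∈ with ∈-map⁻ mulMod r∈
        ... | x , x∈ , refl = mulMod-unit x∈

    euler-≥2 : + m ℤ∣.∣ (+ b) ^ φ m - 1ℤ
    euler-≥2 = subst (+ m ℤ∣.∣_) (negate ((+ b) ^ φ m)) (ℤ∣.∣m⇒∣-m (∣-cancel-coprime (1ℤ - (+ b) ^ φ m) P⊥m m∣P[1-bᶠ]))
      where
      P = product (units m)
      P⊥m : Coprime P m
      P⊥m = coprime-product (All.tabulate (λ x∈ → proj₂ (proj₂ (∈-units⁻ x∈))))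
      m∣P[1-bᶠ] : + m ℤ∣.∣ + P * (1ℤ - (+ b) ^ φ m)
      m∣P[1-bᶠ] = subst (+ m ℤ∣.∣_)
        (trans (cong₂ (λ p l → + p - (+ b) ^ l * + P) (product-↭ mulMod-permutes) (sym (φ≡length-units m)))
               (factor (+ P) ((+ b) ^ φ m)))
        (∣-product-map-% m b (units m))
        where
        factor : ∀ p q → p - q * p ≡ p * (1ℤ - q)
        factor = solve-∀
      negate : ∀ q → - (1ℤ - q) ≡ q - 1ℤ
      negate = solve-∀

  euler : ∀ {m b} → 1 ≤ m → Coprime b m → + m ℤ∣.∣ (+ b) ^ φ m - 1ℤ
  euler {suc zero}    _ _   = ℤ∣.∣ᵤ⇒∣ (ℕ∣.1∣ _)
  euler {suc (suc _)} _ b⊥m = euler-≥2 (s≤s (s≤s z≤n)) b⊥m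

  coprime-^ : ∀ {x m} e → Coprime x m → Coprime (x ℕ.^ e) m
  coprime-^ {m = m} zero    _   = Coprime.1-coprimeTo m
  coprime-^         (suc e) x⊥m = coprime-* x⊥m (coprime-^ e x⊥m)

  coprime-^-^ : ∀ {x y} e f → Coprime x y → Coprime (x ℕ.^ e) (y ℕ.^ f)
  coprime-^-^ e f x⊥y = Coprime.sym (coprime-^ f (Coprime.sym (coprime-^ e x⊥y)))

  primes-coprime : ∀ {p q} → Prime p → Prime q → p ≢ q → Coprime p q
  primes-coprime {p} {q} p-prime q-prime p≢q (d∣p , d∣q) with prime⇒irreducible p-prime d∣p
  ... | inj₁ d≡1 = d≡1
  ... | inj₂ refl with prime⇒irreducible q-prime d∣q
  ...   | inj₁ refl = ⊥-elim (¬prime[1] p-prime)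
  ...   | inj₂ refl = ⊥-elim (p≢q refl)

  prime-∤⇒coprime : ∀ {p a} → Prime p → ¬ p ℕ∣.∣ a → Coprime a p
  prime-∤⇒coprime p-prime p∤a (d∣a , d∣p) with prime⇒irreducible p-prime d∣p
  ... | inj₁ d≡1 = d≡1
  ... | inj₂ refl = ⊥-elim (p∤a d∣a)

  coprime-∣⇒*-∣ : ∀ {x y z} → Coprime x y → x ℕ∣.∣ z → y ℕ∣.∣ z → x ℕ.* y ℕ∣.∣ z
  coprime-∣⇒*-∣ {x} {y} x⊥y x∣z y∣z =
    subst (ℕ∣._∣ _) (trans (sym (ℕP.*-identityˡ (lcm x y))) (trans (cong (ℕ._* lcm x y) (sym (Coprime.coprime⇒gcd≡1 x⊥y))) (gcd*lcm x y)))
      (lcm-least x∣z y∣z)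

  ^-∣-^ : ∀ {x y} n → x ℕ∣.∣ y → x ℕ.^ n ℕ∣.∣ y ℕ.^ n
  ^-∣-^ zero    _   = ℕ∣.∣-refl
  ^-∣-^ (suc n) x∣y = ℕ∣.*-pres-∣ x∣y (^-∣-^ n x∣y)

  ^-∣-^ʳ : ∀ p {e n} → e ≤ n → p ℕ.^ e ℕ∣.∣ p ℕ.^ n
  ^-∣-^ʳ p {e} {n} e≤n = divides (p ℕ.^ (n ∸ e)) (begin
    p ℕ.^ n                     ≡⟨ cong (p ℕ.^_) (ℕP.m+[n∸m]≡n e≤n) ⟨
    p ℕ.^ (e ℕ.+ (n ∸ e))       ≡⟨ ℕP.^-distribˡ-+-* p e (n ∸ e) ⟩
    p ℕ.^ e ℕ.* p ℕ.^ (n ∸ e)   ≡⟨ ℕP.*-comm (p ℕ.^ e) _ ⟩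
    p ℕ.^ (n ∸ e) ℕ.* p ℕ.^ e   ∎)
    where open ≡-Reasoning

  primePower : ℕ × ℕ → ℕ
  primePower (p , e) = p ℕ.^ e

  primePower-coprime-product : ∀ {p} e fac → Prime p → All (λ qf → Prime (proj₁ qf)) fac →
    All (λ qf → p ≢ proj₁ qf) fac → Coprime (p ℕ.^ e) (product (map primePower fac))
  primePower-coprime-product {p} e []             _ _ _ = Coprime.sym (Coprime.1-coprimeTo (p ℕ.^ e))
  primePower-coprime-product     e ((q , f) ∷ fac) p-prime (q-prime ∷ primes) (p≢q ∷ p≢fac) =
    coprime-*ʳ (coprime-^-^ e f (primes-coprime p-prime q-prime p≢q)) (primePower-coprime-product e fac p-prime primes p≢fac)

  record CoprimeSplit (a n m : ℕ) : Set where
    field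
      m₁ m₂     : ℕ
      m≡m₁*m₂   : m ≡ m₁ ℕ.* m₂
      m₁⊥m₂     : Coprime m₁ m₂
      m₁∣aⁿ     : m₁ ℕ∣.∣ a ℕ.^ n
      a⊥m₂      : Coprime a m₂

  split-by-divisors : ∀ a n fac → All (λ pe → Prime (proj₁ pe)) fac → AllPairs (λ pe qf → proj₁ pe ≢ proj₁ qf) fac →
    All (λ pe → proj₂ pe ≤ n) fac → CoprimeSplit a n (product (map primePower fac))
  split-by-divisors a n [] [] [] [] = record
    { m₁ = 1 ; m₂ = 1 ; m≡m₁*m₂ = refl ; m₁⊥m₂ = Coprime.1-coprimeTo 1
    ; m₁∣aⁿ = ℕ∣.1∣ _ ; a⊥m₂ = Coprime.sym (Coprime.1-coprimeTo a) }
  split-by-divisors a n ((p , e) ∷ fac) (p-prime ∷ primes) (p≢fac ∷ distinct) (e≤n ∷ bounded)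
    with split-by-divisors a n fac primes distinct bounded | p ∣? a
  ... | s | yes p∣a = record
    { m₁ = p ℕ.^ e ℕ.* m₁ ; m₂ = m₂
    ; m≡m₁*m₂ = trans (cong (p ℕ.^ e ℕ.*_) m≡m₁*m₂) (sym (ℕP.*-assoc (p ℕ.^ e) m₁ m₂))
    ; m₁⊥m₂ = coprime-* (coprime-∣ʳ pᵉ⊥rest m₂∣rest) m₁⊥m₂
    ; m₁∣aⁿ = coprime-∣⇒*-∣ (coprime-∣ʳ pᵉ⊥rest m₁∣rest) (ℕ∣.∣-trans (^-∣-^ʳ p e≤n) (^-∣-^ n p∣a)) m₁∣aⁿ
    ; a⊥m₂ = a⊥m₂ }
    where
    open CoprimeSplit s
    pᵉ⊥rest = primePower-coprime-product e fac p-prime primes p≢fac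
    m₁∣rest = ℕ∣.∣-trans (ℕ∣.m∣m*n m₂) (ℕ∣.∣-reflexive (sym m≡m₁*m₂))
    m₂∣rest = ℕ∣.∣-trans (ℕ∣.n∣m*n m₁) (ℕ∣.∣-reflexive (sym m≡m₁*m₂))
  ... | s | no p∤a = record
    { m₁ = m₁ ; m₂ = p ℕ.^ e ℕ.* m₂
    ; m≡m₁*m₂ = trans (cong (p ℕ.^ e ℕ.*_) m≡m₁*m₂) (ℕ-x∙yz≈y∙xz (p ℕ.^ e) m₁ m₂)
    ; m₁⊥m₂ = coprime-*ʳ (Coprime.sym (coprime-∣ʳ pᵉ⊥rest m₁∣rest)) m₁⊥m₂
    ; m₁∣aⁿ = m₁∣aⁿ
    ; a⊥m₂ = coprime-*ʳ (Coprime.sym (coprime-^ e (Coprime.sym (prime-∤⇒coprime p-prime p∤a)))) a⊥m₂ }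
    where
    open CoprimeSplit s
    pᵉ⊥rest = primePower-coprime-product e fac p-prime primes p≢fac
    m₁∣rest = ℕ∣.∣-trans (ℕ∣.m∣m*n m₂) (ℕ∣.∣-reflexive (sym m≡m₁*m₂))

  ∣-^-sub-^ : ∀ {m} x y k → + m ℤ∣.∣ x - y → + m ℤ∣.∣ x ^ k - y ^ k
  ∣-^-sub-^ x y zero    _    = divides 0ℤ refl
  ∣-^-sub-^ x y (suc k) m∣x-y = subst (_ ℤ∣.∣_) (sym (telescope x y (x ^ k) (y ^ k)))
    (ℤ∣.∣m∣n⇒∣m+n (ℤ∣.∣n⇒∣m*n x (∣-^-sub-^ x y k m∣x-y)) (ℤ∣.∣n⇒∣m*n (y ^ k) m∣x-y))
    where
    telescope : ∀ x y X Y → x * X - y * Y ≡ x * (X - Y) + Y * (x - y)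
    telescope = solve-∀

  ∣-*-∣ : ∀ {m₁ m₂ x y} → + m₁ ℤ∣.∣ x → + m₂ ℤ∣.∣ y → + (m₁ ℕ.* m₂) ℤ∣.∣ x * y
  ∣-*-∣ {m₁} {m₂} (divides q₁ refl) (divides q₂ refl) =
    divides (q₁ * q₂) (trans (regroup q₁ (+ m₁) q₂ (+ m₂)) (cong (q₁ * q₂ *_) (sym (ℤP.pos-* m₁ m₂))))
    where
    regroup : ∀ a b c d → (a * b) * (c * d) ≡ (a * c) * (b * d)
    regroup = solve-∀

  pos-^ : ∀ a e → + (a ℕ.^ e) ≡ (+ a) ^ e
  pos-^ a zero    = refl
  pos-^ a (suc e) = trans (ℤP.pos-* a (a ℕ.^ e)) (cong (+ a *_) (pos-^ a e))

  ∣-^-periodic-split : ∀ {a n m₁ m₂} → 1 ≤ m₁ ℕ.* m₂ → Coprime m₁ m₂ → m₁ ℕ∣.∣ a ℕ.^ n → Coprime a m₂ →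
    + (m₁ ℕ.* m₂) ℤ∣.∣ (+ a) ^ (n ℕ.+ φ (m₁ ℕ.* m₂)) - (+ a) ^ n
  -- b = a + m₂ is coprime to m₁ m₂ and congruent to a modulo m₂.
  ∣-^-periodic-split {a} {n} {m₁} {m₂} 1≤m m₁⊥m₂ m₁∣aⁿ a⊥m₂ =
    subst (_ ℤ∣.∣_) (sym expand) (∣-*-∣ m₁∣[+a]ⁿ m₂∣aᶠ-1)
    where
    m = m₁ ℕ.* m₂
    b = a ℕ.+ m₂
    b⊥m₂ : Coprime b m₂
    b⊥m₂ = subst (λ t → Coprime t m₂) (ℕP.+-comm m₂ a) (Coprime.coprime-+ a⊥m₂)
    b⊥m₁ : Coprime b m₁
    b⊥m₁ {d} (d∣b , d∣m₁) = Coprime.sym (coprime-^ n (Coprime.sym d⊥a)) (ℕ∣.∣-refl , ℕ∣.∣-trans d∣m₁ m₁∣aⁿ)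
      where
      d⊥a : Coprime d a
      d⊥a (i∣d , i∣a) = m₁⊥m₂ (ℕ∣.∣-trans i∣d d∣m₁ , ℕ∣.∣m+n∣m⇒∣n (ℕ∣.∣-trans i∣d d∣b) i∣a)
    m₂∣b-a : + m₂ ℤ∣.∣ + b - + a
    m₂∣b-a = divides 1ℤ (trans (cong (_- + a) (ℤP.pos-+ a m₂)) (cancel (+ a) (+ m₂)))
      where
      cancel : ∀ x y → x + y - x ≡ 1ℤ * y
      cancel = solve-∀
    m₂∣bᶠ-1 : + m₂ ℤ∣.∣ (+ b) ^ φ m - 1ℤ
    m₂∣bᶠ-1 = ℤ∣.∣-trans (ℤ∣.∣ᵤ⇒∣ (ℕ∣.n∣m*n m₁)) (euler 1≤m (coprime-*ʳ b⊥m₁ b⊥m₂))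
    m₂∣aᶠ-1 : + m₂ ℤ∣.∣ (+ a) ^ φ m - 1ℤ
    m₂∣aᶠ-1 = subst (_ ℤ∣.∣_) (rearrange ((+ b) ^ φ m) ((+ a) ^ φ m))
      (ℤ∣.∣m∣n⇒∣m-n m₂∣bᶠ-1 (∣-^-sub-^ (+ b) (+ a) (φ m) m₂∣b-a))
      where
      rearrange : ∀ B A → B - 1ℤ - (B - A) ≡ A - 1ℤ
      rearrange = solve-∀
    m₁∣[+a]ⁿ : + m₁ ℤ∣.∣ (+ a) ^ n
    m₁∣[+a]ⁿ = subst (_ ℤ∣.∣_) (pos-^ a n) (ℤ∣.∣ᵤ⇒∣ m₁∣aⁿ)
    expand : (+ a) ^ (n ℕ.+ φ m) - (+ a) ^ n ≡ (+ a) ^ n * ((+ a) ^ φ m - 1ℤ)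
    expand = trans (cong (_- (+ a) ^ n) (ℤP.^-distribˡ-+-* (+ a) n (φ m))) (factor ((+ a) ^ n) ((+ a) ^ φ m))
      where
      factor : ∀ X Y → X * Y - X ≡ X * (Y - 1ℤ)
      factor = solve-∀

  ∣-^-periodic : ∀ {m} fac → 1 ≤ m → All (λ pe → Prime (proj₁ pe)) fac → AllPairs (λ pe qf → proj₁ pe ≢ proj₁ qf) fac →
    m ≡ product (map primePower fac) → ∀ {n} → All (λ pe → proj₂ pe ≤ n) fac →
    ∀ a → + m ℤ∣.∣ (+ a) ^ (n ℕ.+ φ m) - (+ a) ^ n
  ∣-^-periodic {m} fac 1≤m primes distinct refl {n} bounded a =
    subst (λ k → + k ℤ∣.∣ (+ a) ^ (n ℕ.+ φ k) - (+ a) ^ n) (sym m≡m₁*m₂)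
      (∣-^-periodic-split {n = n} (subst (1 ≤_) m≡m₁*m₂ 1≤m) m₁⊥m₂ m₁∣aⁿ a⊥m₂)
    where open CoprimeSplit (split-by-divisors a n fac primes distinct bounded)

module GeneratingFunction where

  open import Data.Nat as ℕ using (ℕ; zero; suc; _≤_; _<_; _∸_; _!)
  import Data.Nat.Properties as ℕP
  open import Data.Nat.Coprimality as Coprime using (Coprime)
  open import Data.Integer as ℤ using (ℤ; -[1+_])
  import Data.Integer.Properties as ℤP
  open import Data.Rational as ℚ using (ℚ; mkℚ; 0ℚ; 1ℚ; _+_; _*_; -_; _-_)
  import Data.Rational.Properties as ℚP
  open import Relation.Binary.PropositionalEquality
  open import Data.Integer.Divisibility.Signed as ℤ∣ using (divides)
  open import Data.Product using (_,_)
  open import Algebra.Properties.Ring ℚP.+-*-ring using (x[y-z]≈xy-xz; [y-z]x≈yx-zx; -‿involutive)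
  open import Algebra.Properties.CommutativeSemigroup (CommutativeRing.*-commutativeSemigroup ℚP.+-*-commutativeRing) using (x∙yz≈y∙xz)

  open FiniteSum ℚP.+-*-commutativeRing
  module Σℤ = FiniteSum ℤP.+-*-commutativeRing
  open IntegerPolyBernoulli using (A; polyBℤ; polyBℤ-dual; ∣-Σ-polyBℤ-suc)
  open Congruences using (pos-^)

  ι : ℤ → ℚ
  ι z = z ℚ./ 1

  ι-mkℚ : ∀ z → ι z ≡ mkℚ z 0 (Coprime.sym (Coprime.1-coprimeTo ℤ.∣ z ∣))
  ι-mkℚ (ℤ.+ n)  = ℚP.normalize-coprime (Coprime.sym (Coprime.1-coprimeTo n))
  ι-mkℚ -[1+ n ] = cong -_ (ℚP.normalize-coprime (Coprime.sym (Coprime.1-coprimeTo (suc n))))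

  ι-homo-+ : ∀ a b → ι (a ℤ.+ b) ≡ ι a + ι b
  ι-homo-+ a b rewrite ι-mkℚ a | ι-mkℚ b =
    cong ι (sym (cong₂ ℤ._+_ (ℤP.*-identityʳ a) (ℤP.*-identityʳ b)))

  ι-homo-* : ∀ a b → ι (a ℤ.* b) ≡ ι a * ι b
  ι-homo-* a b rewrite ι-mkℚ a | ι-mkℚ b = refl

  ι-homo-- : ∀ a → ι (ℤ.- a) ≡ - ι a
  ι-homo-- a rewrite ι-mkℚ a | ι-mkℚ (ℤ.- a) = neg-mkℚ a
    where
    neg-mkℚ : ∀ a → mkℚ (ℤ.- a) 0 (Coprime.sym (Coprime.1-coprimeTo ℤ.∣ ℤ.- a ∣))
                  ≡ - mkℚ a 0 (Coprime.sym (Coprime.1-coprimeTo ℤ.∣ a ∣))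
    neg-mkℚ (ℤ.+ zero)  = refl
    neg-mkℚ (ℤ.+ suc n) = refl
    neg-mkℚ -[1+ n ]    = refl

  ι-homo-minus : ∀ a b → ι (a ℤ.- b) ≡ ι a - ι b
  ι-homo-minus a b = trans (ι-homo-+ a (ℤ.- b)) (cong (ι a +_) (ι-homo-- b))

  ι-homo-Σ : ∀ n (f : ℕ → ℤ) → ι (Σℤ.Σ n f) ≡ Σ n (λ i → ι (f i))
  ι-homo-Σ zero    f = refl
  ι-homo-Σ (suc n) f = trans (ι-homo-+ (Σℤ.Σ n f) (f n)) (cong (_+ ι (f n)) (ι-homo-Σ n f))

  Σ<≡Σ : ∀ n f → Σ< n f ≡ Σ n f
  Σ<≡Σ zero    f = refl
  Σ<≡Σ (suc n) f = cong (_+ f n) (Σ<≡Σ n f)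

  ⊛-as-Σ : ∀ (f g : Series) n → (f ⊛ g) n ≡ Σ (suc n) (λ i → f i * g (n ∸ i))
  ⊛-as-Σ f g n = Σ<≡Σ (suc n) _

  ⊛-cong : ∀ {f f′ g g′ : Series} n → (∀ i → f i ≡ f′ i) → (∀ i → g i ≡ g′ i) → (f ⊛ g) n ≡ (f′ ⊛ g′) n
  ⊛-cong {f} {f′} {g} {g′} n f≡f′ g≡g′ = begin
    (f ⊛ g) n                          ≡⟨ ⊛-as-Σ f g n ⟩
    Σ (suc n) (λ i → f i * g (n ∸ i))   ≡⟨ Σ-cong (suc n) (λ i → cong₂ _*_ (f≡f′ i) (g≡g′ (n ∸ i))) ⟩
    Σ (suc n) (λ i → f′ i * g′ (n ∸ i)) ≡⟨ ⊛-as-Σ f′ g′ n ⟨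
    (f′ ⊛ g′) n                         ∎
    where open ≡-Reasoning

  ⊛-distribʳ-- : ∀ (f g h : Series) n → ((λ i → f i - g i) ⊛ h) n ≡ (f ⊛ h) n - (g ⊛ h) n
  ⊛-distribʳ-- f g h n = begin
    ((λ i → f i - g i) ⊛ h) n
      ≡⟨ ⊛-as-Σ (λ i → f i - g i) h n ⟩
    Σ (suc n) (λ i → (f i - g i) * h (n ∸ i))
      ≡⟨ Σ-cong (suc n) (λ i → [y-z]x≈yx-zx (h (n ∸ i)) (f i) (g i)) ⟩
    Σ (suc n) (λ i → f i * h (n ∸ i) - g i * h (n ∸ i))
      ≡⟨ Σ-distrib-- (suc n) _ _ ⟩
    Σ (suc n) (λ i → f i * h (n ∸ i)) - Σ (suc n) (λ i → g i * h (n ∸ i))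
      ≡⟨ cong₂ _-_ (⊛-as-Σ f h n) (⊛-as-Σ g h n) ⟨
    (f ⊛ h) n - (g ⊛ h) n ∎
    where open ≡-Reasoning

  ⊛-distribˡ-- : ∀ (f g h : Series) n → (f ⊛ (λ i → g i - h i)) n ≡ (f ⊛ g) n - (f ⊛ h) n
  ⊛-distribˡ-- f g h n = begin
    (f ⊛ (λ i → g i - h i)) n
      ≡⟨ ⊛-as-Σ f (λ i → g i - h i) n ⟩
    Σ (suc n) (λ i → f i * (g (n ∸ i) - h (n ∸ i)))
      ≡⟨ Σ-cong (suc n) (λ i → x[y-z]≈xy-xz (f i) (g (n ∸ i)) (h (n ∸ i))) ⟩
    Σ (suc n) (λ i → f i * g (n ∸ i) - f i * h (n ∸ i))
      ≡⟨ Σ-distrib-- (suc n) _ _ ⟩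
    Σ (suc n) (λ i → f i * g (n ∸ i)) - Σ (suc n) (λ i → f i * h (n ∸ i))
      ≡⟨ cong₂ _-_ (⊛-as-Σ f g n) (⊛-as-Σ f h n) ⟨
    (f ⊛ g) n - (f ⊛ h) n ∎
    where open ≡-Reasoning

  ⊛-*ˡ : ∀ (f g : Series) c n → (f ⊛ (λ i → c * g i)) n ≡ c * (f ⊛ g) n
  ⊛-*ˡ f g c n = begin
    (f ⊛ (λ i → c * g i)) n              ≡⟨ ⊛-as-Σ f (λ i → c * g i) n ⟩
    Σ (suc n) (λ i → f i * (c * g (n ∸ i))) ≡⟨ Σ-cong (suc n) (λ i → x∙yz≈y∙xz (f i) c (g (n ∸ i))) ⟩
    Σ (suc n) (λ i → c * (f i * g (n ∸ i))) ≡⟨ *-distribˡ-Σ (suc n) c _ ⟨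
    c * Σ (suc n) (λ i → f i * g (n ∸ i))   ≡⟨ cong (c *_) (⊛-as-Σ f g n) ⟨
    c * (f ⊛ g) n                           ∎
    where open ≡-Reasoning

  ⊛-zeroʳ : ∀ (f g : Series) n → (∀ i → g i ≡ 0ℚ) → (f ⊛ g) n ≡ 0ℚ
  ⊛-zeroʳ f g n g≡0 = trans (⊛-as-Σ f g n)
    (Σ-zero (suc n) (λ i _ → trans (cong (f i *_) (g≡0 (n ∸ i))) (ℚP.*-zeroʳ (f i))))

  ⊛-identityˡ : ∀ (g : Series) n → (oneS ⊛ g) n ≡ g n
  ⊛-identityˡ g n = begin
    (oneS ⊛ g) n                                            ≡⟨ ⊛-as-Σ oneS g n ⟩
    Σ (suc n) (λ i → oneS i * g (n ∸ i))                    ≡⟨ Σ-suc n _ ⟩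
    1ℚ * g n + Σ n (λ i → 0ℚ * g (n ∸ suc i))                ≡⟨ cong₂ _+_ (ℚP.*-identityˡ (g n)) (Σ-zero n (λ i _ → ℚP.*-zeroˡ (g (n ∸ suc i)))) ⟩
    g n + 0ℚ                                                ≡⟨ ℚP.+-identityʳ (g n) ⟩
    g n                                                     ∎
    where open ≡-Reasoning

  ⊛-identityʳ : ∀ (f : Series) n → (f ⊛ oneS) n ≡ f n
  ⊛-identityʳ f n = begin
    (f ⊛ oneS) n                                 ≡⟨ ⊛-as-Σ f oneS n ⟩
    Σ n (λ i → f i * oneS (n ∸ i)) + f n * oneS (n ∸ n)
      ≡⟨ cong₂ _+_ (Σ-zero n off-diagonal) (trans (cong (λ t → f n * oneS t) (ℕP.n∸n≡0 n)) (ℚP.*-identityʳ (f n))) ⟩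
    0ℚ + f n                                     ≡⟨ ℚP.+-identityˡ (f n) ⟩
    f n                                          ∎
    where
    open ≡-Reasoning
    off-diagonal : ∀ i → i < n → f i * oneS (n ∸ i) ≡ 0ℚ
    off-diagonal i i<n = trans (cong (λ t → f i * oneS t) (ℕP.+-∸-assoc 1 i<n)) (ℚP.*-zeroʳ (f i))

  ∂ : Series → Series
  ∂ f k = ι (ℤ.+ suc k) * f (suc k)

  ∂-Leibniz : ∀ (f g : Series) k → ∂ (f ⊛ g) k ≡ (∂ f ⊛ g) k + (f ⊛ ∂ g) k
  ∂-Leibniz f g k = begin
    ι (ℤ.+ suc k) * (f ⊛ g) (suc k)                  ≡⟨ cong (ι (ℤ.+ suc k) *_) (⊛-as-Σ f g (suc k)) ⟩
    ι (ℤ.+ suc k) * Σ (suc (suc k)) t                ≡⟨ *-distribˡ-Σ (suc (suc k)) (ι (ℤ.+ suc k)) t ⟩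
    Σ (suc (suc k)) (λ i → ι (ℤ.+ suc k) * t i)      ≡⟨ Σ-cong-< (suc (suc k)) split-weight ⟩
    Σ (suc (suc k)) (λ i → left i + right i)         ≡⟨ Σ-distrib-+ (suc (suc k)) left right ⟩
    Σ (suc (suc k)) left + Σ (suc (suc k)) right     ≡⟨ cong₂ _+_ left-sum right-sum ⟩
    (∂ f ⊛ g) k + (f ⊛ ∂ g) k                        ∎
    where
    open ≡-Reasoning
    t left right : ℕ → ℚ
    t i = f i * g (suc k ∸ i)
    left i = ι (ℤ.+ i) * t i
    right i = ι (ℤ.+ (suc k ∸ i)) * t i
    split-weight : ∀ i → i < suc (suc k) → ι (ℤ.+ suc k) * t i ≡ left i + right i
    split-weight i i<2+k = begin
      ι (ℤ.+ suc k) * t i                          ≡⟨ cong (λ n → ι (ℤ.+ n) * t i) (ℕP.m+[n∸m]≡n (ℕP.≤-pred i<2+k)) ⟨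
      ι (ℤ.+ i ℤ.+ ℤ.+ (suc k ∸ i)) * t i          ≡⟨ cong (_* t i) (ι-homo-+ (ℤ.+ i) (ℤ.+ (suc k ∸ i))) ⟩
      (ι (ℤ.+ i) + ι (ℤ.+ (suc k ∸ i))) * t i      ≡⟨ ℚP.*-distribʳ-+ (t i) (ι (ℤ.+ i)) (ι (ℤ.+ (suc k ∸ i))) ⟩
      left i + right i                              ∎
    left-sum : Σ (suc (suc k)) left ≡ (∂ f ⊛ g) k
    left-sum = begin
      Σ (suc (suc k)) left                          ≡⟨ Σ-suc (suc k) left ⟩
      0ℚ * t 0 + Σ (suc k) (λ i → left (suc i))     ≡⟨ cong (_+ Σ (suc k) (λ i → left (suc i))) (ℚP.*-zeroˡ (t 0)) ⟩
      0ℚ + Σ (suc k) (λ i → left (suc i))           ≡⟨ ℚP.+-identityˡ _ ⟩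
      Σ (suc k) (λ i → left (suc i))                ≡⟨ Σ-cong (suc k) (λ i → ℚP.*-assoc (ι (ℤ.+ suc i)) (f (suc i)) (g (k ∸ i))) ⟨
      Σ (suc k) (λ i → ∂ f i * g (k ∸ i))           ≡⟨ ⊛-as-Σ (∂ f) g k ⟨
      (∂ f ⊛ g) k                                   ∎
    right-sum : Σ (suc (suc k)) right ≡ (f ⊛ ∂ g) k
    right-sum = begin
      Σ (suc k) right + right (suc k)               ≡⟨ cong (Σ (suc k) right +_) (trans (cong (λ n → ι (ℤ.+ n) * t (suc k)) (ℕP.n∸n≡0 (suc k))) (ℚP.*-zeroˡ (t (suc k)))) ⟩
      Σ (suc k) right + 0ℚ                          ≡⟨ ℚP.+-identityʳ _ ⟩
      Σ (suc k) right                               ≡⟨ Σ-cong-< (suc k) (λ i i<1+k → trans (cong (λ n → ι (ℤ.+ n) * (f i * g n)) (ℕP.+-∸-assoc 1 (ℕP.≤-pred i<1+k))) (x∙yz≈y∙xz (ι (ℤ.+ suc (k ∸ i))) (f i) (g (suc (k ∸ i))))) ⟩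
      Σ (suc k) (λ i → f i * ∂ g (k ∸ i))           ≡⟨ ⊛-as-Σ f (∂ g) k ⟨
      (f ⊛ ∂ g) k                                   ∎

  ι-n!*inv!≡1 : ∀ n → ι (ℤ.+ (n !)) * inv! n ≡ 1ℚ
  ι-n!*inv!≡1 n = ι-*-inverse (n !) {{n ℕP.!≢0}}
    where
    ι-*-inverse : ∀ m .{{_ : ℕ.NonZero m}} → ι (ℤ.+ m) * (ℤ.+ 1 ℚ./ m) ≡ 1ℚ
    ι-*-inverse (suc m) = trans
      (cong₂ _*_ (ι-mkℚ (ℤ.+ suc m)) (ℚP.normalize-coprime (Coprime.1-coprimeTo (suc m))))
      (ℚP.*-inverseʳ (mkℚ (ℤ.+ suc m) 0 (Coprime.sym (Coprime.1-coprimeTo (suc m)))))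

  suc*inv!-suc : ∀ k → ι (ℤ.+ suc k) * inv! (suc k) ≡ inv! k
  suc*inv!-suc k = begin
    ι (ℤ.+ suc k) * inv! (suc k)                              ≡⟨ ℚP.*-identityˡ _ ⟨
    1ℚ * (ι (ℤ.+ suc k) * inv! (suc k))                       ≡⟨ cong (_* (ι (ℤ.+ suc k) * inv! (suc k))) (trans (ℚP.*-comm (inv! k) _) (ι-n!*inv!≡1 k)) ⟨
    (inv! k * ι (ℤ.+ (k !))) * (ι (ℤ.+ suc k) * inv! (suc k)) ≡⟨ ℚP.*-assoc (inv! k) _ _ ⟩
    inv! k * (ι (ℤ.+ (k !)) * (ι (ℤ.+ suc k) * inv! (suc k))) ≡⟨ cong (inv! k *_) (ℚP.*-assoc (ι (ℤ.+ (k !))) (ι (ℤ.+ suc k)) (inv! (suc k))) ⟨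
    inv! k * ((ι (ℤ.+ (k !)) * ι (ℤ.+ suc k)) * inv! (suc k)) ≡⟨ cong (λ x → inv! k * (x * inv! (suc k))) ι-suc-k! ⟩
    inv! k * (ι (ℤ.+ (suc k !)) * inv! (suc k))               ≡⟨ cong (inv! k *_) (ι-n!*inv!≡1 (suc k)) ⟩
    inv! k * 1ℚ                                               ≡⟨ ℚP.*-identityʳ (inv! k) ⟩
    inv! k                                                    ∎
    where
    open ≡-Reasoning
    ι-suc-k! : ι (ℤ.+ (k !)) * ι (ℤ.+ suc k) ≡ ι (ℤ.+ (suc k !))
    ι-suc-k! = begin
      ι (ℤ.+ (k !)) * ι (ℤ.+ suc k)   ≡⟨ ℚP.*-comm (ι (ℤ.+ (k !))) (ι (ℤ.+ suc k)) ⟩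
      ι (ℤ.+ suc k) * ι (ℤ.+ (k !))   ≡⟨ ι-homo-* (ℤ.+ suc k) (ℤ.+ (k !)) ⟨
      ι (ℤ.+ suc k ℤ.* ℤ.+ (k !))     ≡⟨ cong ι (ℤP.pos-* (suc k) (k !)) ⟨
      ι (ℤ.+ (suc k !))               ∎

  private
    u : Series
    u = oneMinusExpNeg

  ∂-oneMinusExpNeg : ∀ k → ∂ u k ≡ oneS k - u k
  ∂-oneMinusExpNeg k = trans ∂u≡e⁻ᵗ (e⁻ᵗ k)
    where
    open ≡-Reasoning
    ∂u≡e⁻ᵗ : ∂ u k ≡ sgn k * inv! k
    ∂u≡e⁻ᵗ = begin
      ι (ℤ.+ suc k) * - (- sgn k * inv! (suc k)) ≡⟨ cong (ι (ℤ.+ suc k) *_) (trans (ℚP.neg-distribˡ-* (- sgn k) (inv! (suc k))) (cong (_* inv! (suc k)) (-‿involutive (sgn k)))) ⟩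
      ι (ℤ.+ suc k) * (sgn k * inv! (suc k))     ≡⟨ x∙yz≈y∙xz (ι (ℤ.+ suc k)) (sgn k) (inv! (suc k)) ⟩
      sgn k * (ι (ℤ.+ suc k) * inv! (suc k))     ≡⟨ cong (sgn k *_) (suc*inv!-suc k) ⟩
      sgn k * inv! k                             ∎
    e⁻ᵗ : ∀ k → sgn k * inv! k ≡ oneS k - u k
    e⁻ᵗ zero    = refl
    e⁻ᵗ (suc k) = sym (trans (ℚP.+-identityˡ _) (-‿involutive (sgn (suc k) * inv! (suc k))))

  ∂-pow : ∀ j k → ∂ (u ^S suc j) k ≡ ι (ℤ.+ suc j) * ((u ^S j) k - (u ^S suc j) k)
  ∂-pow zero k = begin
    ∂ (u ⊛ oneS) k                   ≡⟨ ∂-Leibniz u oneS k ⟩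
    (∂ u ⊛ oneS) k + (u ⊛ ∂ oneS) k  ≡⟨ cong₂ _+_ (trans (⊛-identityʳ (∂ u) k) (∂-oneMinusExpNeg k))
                                                  (⊛-zeroʳ u (∂ oneS) k (λ i → ℚP.*-zeroʳ (ι (ℤ.+ suc i)))) ⟩
    (oneS k - u k) + 0ℚ              ≡⟨ ℚP.+-identityʳ (oneS k - u k) ⟩
    oneS k - u k                     ≡⟨ cong (λ x → oneS k - x) (⊛-identityʳ u k) ⟨
    oneS k - (u ⊛ oneS) k            ≡⟨ ℚP.*-identityˡ (oneS k - (u ⊛ oneS) k) ⟨
    1ℚ * (oneS k - (u ⊛ oneS) k)     ∎
    where open ≡-Reasoning
  ∂-pow (suc j) k = begin
    ∂ (u ⊛ G) k                                    ≡⟨ ∂-Leibniz u G k ⟩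
    (∂ u ⊛ G) k + (u ⊛ ∂ G) k                      ≡⟨ cong₂ _+_ ∂u⊛G u⊛∂G ⟩
    (G k - H k) + ι (ℤ.+ suc j) * (G k - H k)      ≡⟨ cong (_+ ι (ℤ.+ suc j) * (G k - H k)) (ℚP.*-identityˡ (G k - H k)) ⟨
    1ℚ * (G k - H k) + ι (ℤ.+ suc j) * (G k - H k) ≡⟨ ℚP.*-distribʳ-+ (G k - H k) 1ℚ (ι (ℤ.+ suc j)) ⟨
    (1ℚ + ι (ℤ.+ suc j)) * (G k - H k)             ≡⟨ cong (_* (G k - H k)) (ι-homo-+ (ℤ.+ 1) (ℤ.+ suc j)) ⟨
    ι (ℤ.+ suc (suc j)) * (G k - H k)              ∎
    where
    open ≡-Reasoning
    G H : Series
    G = u ^S suc j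
    H = u ^S suc (suc j)
    ∂u⊛G : (∂ u ⊛ G) k ≡ G k - H k
    ∂u⊛G = begin
      (∂ u ⊛ G) k                    ≡⟨ ⊛-cong {f′ = λ i → oneS i - u i} {g′ = G} k ∂-oneMinusExpNeg (λ _ → refl) ⟩
      ((λ i → oneS i - u i) ⊛ G) k   ≡⟨ ⊛-distribʳ-- oneS u G k ⟩
      (oneS ⊛ G) k - H k             ≡⟨ cong (_- H k) (⊛-identityˡ G k) ⟩
      G k - H k                      ∎
    u⊛∂G : (u ⊛ ∂ G) k ≡ ι (ℤ.+ suc j) * (G k - H k)
    u⊛∂G = begin
      (u ⊛ ∂ G) k                                             ≡⟨ ⊛-cong {f′ = u} {g′ = λ i → ι (ℤ.+ suc j) * ((u ^S j) i - G i)} k (λ _ → refl) (∂-pow j) ⟩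
      (u ⊛ (λ i → ι (ℤ.+ suc j) * ((u ^S j) i - G i))) k      ≡⟨ ⊛-*ˡ u (λ i → (u ^S j) i - G i) (ι (ℤ.+ suc j)) k ⟩
      ι (ℤ.+ suc j) * (u ⊛ (λ i → (u ^S j) i - G i)) k        ≡⟨ cong (ι (ℤ.+ suc j) *_) (⊛-distribˡ-- u (u ^S j) G k) ⟩
      ι (ℤ.+ suc j) * (G k - H k)                             ∎

  k!*coeff-pow : ∀ k j → ι (ℤ.+ (k !)) * (u ^S j) k ≡ ι (A j k)
  k!*coeff-pow zero    zero    = refl
  k!*coeff-pow zero    (suc j) = begin
    ι (ℤ.+ 1) * (0ℚ + 0ℚ * (u ^S j) 0) ≡⟨ cong (ι (ℤ.+ 1) *_) (trans (ℚP.+-identityˡ _) (ℚP.*-zeroˡ ((u ^S j) 0))) ⟩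
    ι (ℤ.+ 1) * 0ℚ                      ≡⟨ ℚP.*-zeroʳ (ι (ℤ.+ 1)) ⟩
    0ℚ                                  ∎
    where open ≡-Reasoning
  k!*coeff-pow (suc k) j = begin
    ι (ℤ.+ (suc k !)) * (u ^S j) (suc k)       ≡⟨ cong (_* (u ^S j) (suc k)) ι-[1+k]! ⟩
    (ι (ℤ.+ (k !)) * ι (ℤ.+ suc k)) * (u ^S j) (suc k) ≡⟨ ℚP.*-assoc (ι (ℤ.+ (k !))) _ _ ⟩
    ι (ℤ.+ (k !)) * ∂ (u ^S j) k               ≡⟨ derivative j ⟩
    ι (A j (suc k))                            ∎
    where
    open ≡-Reasoning
    ι-[1+k]! : ι (ℤ.+ (suc k !)) ≡ ι (ℤ.+ (k !)) * ι (ℤ.+ suc k)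
    ι-[1+k]! = begin
      ι (ℤ.+ (suc k !))               ≡⟨ cong ι (ℤP.pos-* (suc k) (k !)) ⟩
      ι (ℤ.+ suc k ℤ.* ℤ.+ (k !))     ≡⟨ ι-homo-* (ℤ.+ suc k) (ℤ.+ (k !)) ⟩
      ι (ℤ.+ suc k) * ι (ℤ.+ (k !))   ≡⟨ ℚP.*-comm (ι (ℤ.+ suc k)) (ι (ℤ.+ (k !))) ⟩
      ι (ℤ.+ (k !)) * ι (ℤ.+ suc k)   ∎
    derivative : ∀ j → ι (ℤ.+ (k !)) * ∂ (u ^S j) k ≡ ι (A j (suc k))
    derivative zero = trans (cong (ι (ℤ.+ (k !)) *_) (ℚP.*-zeroʳ (ι (ℤ.+ suc k)))) (ℚP.*-zeroʳ (ι (ℤ.+ (k !))))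
    derivative (suc j) = begin
      ι (ℤ.+ (k !)) * ∂ (u ^S suc j) k
        ≡⟨ cong (ι (ℤ.+ (k !)) *_) (∂-pow j k) ⟩
      ι (ℤ.+ (k !)) * (ι (ℤ.+ suc j) * ((u ^S j) k - (u ^S suc j) k))
        ≡⟨ x∙yz≈y∙xz (ι (ℤ.+ (k !))) (ι (ℤ.+ suc j)) _ ⟩
      ι (ℤ.+ suc j) * (ι (ℤ.+ (k !)) * ((u ^S j) k - (u ^S suc j) k))
        ≡⟨ cong (ι (ℤ.+ suc j) *_) (x[y-z]≈xy-xz (ι (ℤ.+ (k !))) ((u ^S j) k) ((u ^S suc j) k)) ⟩
      ι (ℤ.+ suc j) * (ι (ℤ.+ (k !)) * (u ^S j) k - ι (ℤ.+ (k !)) * (u ^S suc j) k)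
        ≡⟨ cong₂ (λ a b → ι (ℤ.+ suc j) * (a - b)) (k!*coeff-pow k j) (k!*coeff-pow k (suc j)) ⟩
      ι (ℤ.+ suc j) * (ι (A j k) - ι (A (suc j) k))
        ≡⟨ cong (ι (ℤ.+ suc j) *_) (ι-homo-minus (A j k) (A (suc j) k)) ⟨
      ι (ℤ.+ suc j) * ι (A j k ℤ.- A (suc j) k)
        ≡⟨ ι-homo-* (ℤ.+ suc j) (A j k ℤ.- A (suc j) k) ⟨
      ι (A (suc j) (suc k)) ∎

  polyB≡ι-polyBℤ : ∀ m k → polyB m k ≡ ι (polyBℤ m k)
  polyB≡ι-polyBℤ m k = begin
    ι (ℤ.+ (k !)) * liCoeff m k
      ≡⟨ cong (ι (ℤ.+ (k !)) *_) (Σ<≡Σ (suc k) _) ⟩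
    ι (ℤ.+ (k !)) * Σ (suc k) (λ j → ι (ℤ.+ (suc j ℕ.^ m)) * (u ^S j) k)
      ≡⟨ *-distribˡ-Σ (suc k) (ι (ℤ.+ (k !))) _ ⟩
    Σ (suc k) (λ j → ι (ℤ.+ (k !)) * (ι (ℤ.+ (suc j ℕ.^ m)) * (u ^S j) k))
      ≡⟨ Σ-cong (suc k) term ⟩
    Σ (suc k) (λ j → ι ((ℤ.+ suc j) ℤ.^ m ℤ.* A j k))
      ≡⟨ ι-homo-Σ (suc k) _ ⟨
    ι (polyBℤ m k) ∎
    where
    open ≡-Reasoning
    term : ∀ j → ι (ℤ.+ (k !)) * (ι (ℤ.+ (suc j ℕ.^ m)) * (u ^S j) k) ≡ ι ((ℤ.+ suc j) ℤ.^ m ℤ.* A j k)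
    term j = begin
      ι (ℤ.+ (k !)) * (ι (ℤ.+ (suc j ℕ.^ m)) * (u ^S j) k) ≡⟨ x∙yz≈y∙xz (ι (ℤ.+ (k !))) (ι (ℤ.+ (suc j ℕ.^ m))) ((u ^S j) k) ⟩
      ι (ℤ.+ (suc j ℕ.^ m)) * (ι (ℤ.+ (k !)) * (u ^S j) k) ≡⟨ cong₂ _*_ (cong ι (pos-^ (suc j) m)) (k!*coeff-pow k j) ⟩
      ι ((ℤ.+ suc j) ℤ.^ m) * ι (A j k)                    ≡⟨ ι-homo-* ((ℤ.+ suc j) ℤ.^ m) (A j k) ⟨
      ι ((ℤ.+ suc j) ℤ.^ m ℤ.* A j k)                      ∎

  polyB-dual : ∀ m k → polyB m k ≡ polyB k m
  polyB-dual m k = trans (polyB≡ι-polyBℤ m k) (trans (cong ι (polyBℤ-dual m k)) (sym (polyB≡ι-polyBℤ k m)))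

  Σ<-cong : ∀ n {f g : ℕ → ℚ} → (∀ i → f i ≡ g i) → Σ< n f ≡ Σ< n g
  Σ<-cong zero    f≡g = refl
  Σ<-cong (suc n) f≡g = cong₂ _+_ (Σ<-cong n f≡g) (f≡g n)

  ≡⇒≡[modℚ] : ∀ {x y m} → x ≡ y → x ≡ y [modℚ m ]
  ≡⇒≡[modℚ] {x} {m = m} refl = ℤ.0ℤ , trans (ℚP.+-inverseʳ x) (cong ι (sym (ℤP.*-zeroʳ (ℤ.+ m))))

  ∣⇒ι≡0[modℚ] : ∀ {m z} → ℤ.+ m ℤ∣.∣ z → ι z ≡ 0ℚ [modℚ m ]
  ∣⇒ι≡0[modℚ] {m} (divides q refl) = q , trans (ℚP.+-identityʳ _) (cong ι (ℤP.*-comm q (ℤ.+ m)))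

  Σ<-polyB-suc≡0[modℚ] : ∀ {m} n N k → (∀ a → ℤ.+ m ℤ∣.∣ (ℤ.+ a) ℤ.^ (n ℕ.+ N) ℤ.- (ℤ.+ a) ℤ.^ n) →
    Σ< N (λ i → polyB (n ℕ.+ i) (suc k)) ≡ 0ℚ [modℚ m ]
  Σ<-polyB-suc≡0[modℚ] {m} n N k periodic = subst (_≡ 0ℚ [modℚ m ]) (sym Σ<≡ι-Σ) (∣⇒ι≡0[modℚ] (∣-Σ-polyBℤ-suc n N k periodic))
    where
    Σ<≡ι-Σ : Σ< N (λ i → polyB (n ℕ.+ i) (suc k)) ≡ ι (Σℤ.Σ N (λ i → polyBℤ (n ℕ.+ i) (suc k)))
    Σ<≡ι-Σ = begin
      Σ< N (λ i → polyB (n ℕ.+ i) (suc k))             ≡⟨ Σ<≡Σ N _ ⟩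
      Σ N (λ i → polyB (n ℕ.+ i) (suc k))              ≡⟨ Σ-cong N (λ i → polyB≡ι-polyBℤ (n ℕ.+ i) (suc k)) ⟩
      Σ N (λ i → ι (polyBℤ (n ℕ.+ i) (suc k)))         ≡⟨ ι-homo-Σ N _ ⟨
      ι (Σℤ.Σ N (λ i → polyBℤ (n ℕ.+ i) (suc k)))      ∎
      where open ≡-Reasoning

open import Data.Nat using (ℕ; _≤_; _^_; suc; s≤s; z≤n)
open import Data.Nat.Primality using (Prime)
open import Data.Product using (_×_; proj₁; proj₂; _,_)
open import Data.List using (List; map)
open import Data.Nat.ListAction using (product)
open import Data.List.Relation.Unary.All using (All)
open import Data.List.Relation.Unary.AllPairs using (AllPairs)
open import Relation.Binary.PropositionalEquality using (_≡_; _≢_)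
open import Data.Rational using (0ℚ)
open GeneratingFunction using (polyB-dual; Σ<-cong; ≡⇒≡[modℚ]; Σ<-polyB-suc≡0[modℚ])
open Congruences using (∣-^-periodic)

corollary3p7 : (k M : ℕ) → 1 ≤ k → 1 ≤ M →
    (fac : List (ℕ × ℕ)) →
    All (λ pe → Prime (proj₁ pe)) fac →
    All (λ pe → 1 ≤ proj₂ pe) fac →
    AllPairs (λ pe qf → proj₁ pe ≢ proj₁ qf) fac →
    M ≡ product (map (λ pe → proj₁ pe ^ proj₂ pe) fac) →
    (n : ℕ) → All (λ pe → proj₂ pe ≤ n) fac →
    (Σ< (φ M) (λ i → polyB k (n Data.Nat.+ i)) ≡ Σ< (φ M) (λ i → polyB (n Data.Nat.+ i) k) [modℚ M ])
    × (Σ< (φ M) (λ i → polyB (n Data.Nat.+ i) k) ≡ 0ℚ [modℚ M ])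
corollary3p7 (suc k) M (s≤s z≤n) 1≤M fac primes _ distinct M≡ n bounded =
    ≡⇒≡[modℚ] {m = M} (Σ<-cong (φ M) (λ i → polyB-dual (suc k) (n Data.Nat.+ i)))
  , Σ<-polyB-suc≡0[modℚ] n (φ M) k (∣-^-periodic fac 1≤M primes distinct M≡ bounded)
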